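{- For every $k\in\mathbb N$, the proof system $\mathrm{LK}_{k+\frac12}$ is quasipolynomially equivalent to the system $\mathrm{LK}_k$ extended by shallow decision trees; that is, every $\mathrm{LK}_{k+\frac12}$ refutation of size $s$ of a CNF $F$ can be converted into a refutation of $F$ of size quasipolynomial in $s$ in $\mathrm{LK}_k$ extended by shallow decision trees, and vice versa.
   Context: Formulas are built from propositional literals using unbounded fan-in $\bigwedge$ and $\bigvee$ (negation only on variables); literals have depth $0$ and a conjunction or disjunction of formulas of depth at most $d$ has depth at most $d+1$. A cedent is a finite set of formulas, read as their disjunction. $\mathrm{LK}_k$ (depth-$k$ LK, as a cedent/Tait calculus) is the sequent-calculus system whose lines are cedents of formulas of depth at most $k$, with the standard rules (axioms $\{p,\neg p\}$, weakening, $\wedge$-introduction, $\vee$-introduction, cut). A refutation of a CNF $F$ is a derivation of the empty cedent in which each clause of $F$, taken as a cedent of literals, may be used as an axiom; size is the number of symbols. An $\mathrm{LK}_{k+\frac12}$ proof is an $\mathrm{LK}_{k+1}$ proof in which every subformula of depth $1$ (a conjunction or disjunction of literals) has size at most the logarithm of the size of the proof. For a decision tree $T$ querying variables of $F$, with each branch $b$ identified with the conjunction of literals made true along it and $\neg b$ the clause negating it, the extension axiom for $T$ introduces a new variable $e_T$ and consists of the clauses $\neg b\vee e_T$ for each accepting branch $b$ and $\neg b\vee\neg e_T$ for each rejecting branch $b$. For a proof system $P$ and depth bound $d$, a refutation of $F$ in $P$ extended by depth-$d$ decision trees is a $P$-refutation of $F\wedge A$ where $A$ is a set of extension axioms for decision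 trees of depth at most $d$ over the original variables of $F$; $P$ extended by shallow decision trees is this system with $d$ equal to the logarithm of the size of the refutation. -}

module Defs where

open import Data.Nat using (ℕ; zero; suc; _+_; _*_; _^_; _≤_; _⊔_)
open import Data.Nat.Logarithm using (⌊log₂_⌋)
open import Data.Bool using (Bool; true; false)
open import Data.List using (List; []; _∷_; _++_; map; concatMap)
open import Data.List.Membership.Propositional using (_∈_)
open import Data.List.Relation.Binary.Subset.Propositional using (_⊆_)
open import Data.List.Relation.Unary.All using (All)
open import Data.List.Relation.Unary.AllPairs using (AllPairs)
open import Data.Product using (Σ; _×_; _,_; ∃-syntax)
open import Relation.Binary.PropositionalEquality using (_≡_; _≢_)
open import Relation.Nullary using (¬_)

data Literal : Set where
  pos : ℕ → Literal
  neg : ℕ → Literal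

negLit : Literal → Literal
negLit (pos x) = neg x
negLit (neg x) = pos x

var : Literal → ℕ
var (pos x) = x
var (neg x) = x

data Formula : Set where
  lit : Literal → Formula
  ⋀   : List Formula → Formula
  ⋁   : List Formula → Formula

mutual
  depth : Formula → ℕ
  depth (lit _) = 0
  depth (⋀ fs) = suc (depthL fs)
  depth (⋁ fs) = suc (depthL fs)

  depthL : List Formula → ℕ
  depthL [] = 0
  depthL (f ∷ fs) = depth f ⊔ depthL fs

mutual
  size : Formula → ℕ
  size (lit _) = 1
  size (⋀ fs) = suc (sizeL fs)
  size (⋁ fs) = suc (sizeL fs)

  sizeL : List Formula → ℕ
  sizeL [] = 0
  sizeL (f ∷ fs) = size f + sizeL fs

-- De Morgan dual (the negation of a formula in the Tait calculus)
mutual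
  dual : Formula → Formula
  dual (lit l) = lit (negLit l)
  dual (⋀ fs) = ⋁ (dualL fs)
  dual (⋁ fs) = ⋀ (dualL fs)

  dualL : List Formula → List Formula
  dualL [] = []
  dualL (f ∷ fs) = dual f ∷ dualL fs

data _≼_ : Formula → Formula → Set where
  here  : ∀ {f} → f ≼ f
  inAnd : ∀ {f g fs} → g ∈ fs → f ≼ g → f ≼ ⋀ fs
  inOr  : ∀ {f g fs} → g ∈ fs → f ≼ g → f ≼ ⋁ fs

-- a cedent is a finite set of formulas (represented by a list, read
-- as a set via the weakening rule, which allows arbitrary ⊆)
Cedent : Set
Cedent = List Formula

Clause : Set
Clause = List Literal

CNF : Set
CNF = List Clause

clauseCedent : Clause → Cedent
clauseCedent C = map lit C

-- one symbol per formula symbol, plus one delimiter per line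
cedentSize : Cedent → ℕ
cedentSize Γ = suc (sizeL Γ)

-- LK derivations (dag-like: a sequence of lines, each inferred from
-- earlier lines).  Lines are stored newest first.

data Inference (Ax : CNF) (prev : List Cedent) : Cedent → Set where
  axiom : ∀ p → Inference Ax prev (lit (pos p) ∷ lit (neg p) ∷ [])
  hyp   : ∀ {C} → C ∈ Ax → Inference Ax prev (clauseCedent C)
  weak  : ∀ {Γ Δ} → Γ ∈ prev → Γ ⊆ Δ → Inference Ax prev Δ
  ∧-intro : ∀ Γ fs → All (λ f → (f ∷ Γ) ∈ prev) fs →
            Inference Ax prev (⋀ fs ∷ Γ)
  ∨-intro : ∀ Γ fs → (fs ++ Γ) ∈ prev → Inference Ax prev (⋁ fs ∷ Γ)
  cut   : ∀ Γ A → (A ∷ Γ) ∈ prev → (dual A ∷ Γ) ∈ prev →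
          Inference Ax prev Γ

data Derivation (Ax : CNF) : List Cedent → Set where
  []  : Derivation Ax []
  _▷_ : ∀ {ls Γ} → Derivation Ax ls → Inference Ax ls Γ →
        Derivation Ax (Γ ∷ ls)

record Refutation (Ax : CNF) : Set where
  constructor refutation
  field
    earlier : List Cedent
    deriv   : Derivation Ax ([] ∷ earlier)
open Refutation public

lines : ∀ {Ax} → Refutation Ax → List Cedent
lines π = [] ∷ earlier π

proofSize : List Cedent → ℕ
proofSize [] = 0
proofSize (Γ ∷ ls) = cedentSize Γ + proofSize ls

refSize : ∀ {Ax} → Refutation Ax → ℕ
refSize π = proofSize (lines π)

IsLK : ℕ → ∀ {Ax} → Refutation Ax → Set
IsLK k π = ∀ Γ f → Γ ∈ lines π → f ∈ Γ → depth f ≤ k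

IsLKHalf : ℕ → ∀ {Ax} → Refutation Ax → Set
IsLKHalf k π =
  IsLK (suc k) π ×
  (∀ Γ f g → Γ ∈ lines π → f ∈ Γ → g ≼ f → depth g ≡ 1 →
     size g ≤ ⌊log₂ refSize π ⌋)

-- node x t₀ t₁ queries x; t₀ for x = 0, t₁ for x = 1
data DTree : Set where
  leaf : Bool → DTree
  node : ℕ → DTree → DTree → DTree

dtDepth : DTree → ℕ
dtDepth (leaf _) = 0
dtDepth (node _ t₀ t₁) = suc (dtDepth t₀ ⊔ dtDepth t₁)

queries : DTree → List ℕ
queries (leaf _) = []
queries (node x t₀ t₁) = x ∷ queries t₀ ++ queries t₁

-- a branch: the literals made true along it, and whether it accepts
Branch : Set
Branch = List Literal × Bool

consLit : Literal → Branch → Branch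
consLit l (b , o) = (l ∷ b , o)

branches : DTree → List Branch
branches (leaf o) = ([] , o) ∷ []
branches (node x t₀ t₁) =
  map (consLit (neg x)) (branches t₀) ++ map (consLit (pos x)) (branches t₁)

negBranch : List Literal → Clause
negBranch b = map negLit b

branchAxiom : ℕ → Branch → Clause
branchAxiom e (b , true)  = negBranch b ++ (pos e ∷ [])
branchAxiom e (b , false) = negBranch b ++ (neg e ∷ [])

extAxiom : DTree → ℕ → CNF
extAxiom T e = map (branchAxiom e) (branches T)

-- a list of extensions: (tree, its new variable)
Extension : Set
Extension = DTree × ℕ

extAxioms : List Extension → CNF
extAxioms A = concatMap (λ { (T , e) → extAxiom T e }) A

vars : CNF → List ℕ
vars F = concatMap (map var) F

ValidExt : CNF → ℕ → List Extension → Set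
ValidExt F d A =
  All (λ { (T , e) → (All (_∈ vars F) (queries T)) × dtDepth T ≤ d × ¬ (e ∈ vars F) }) A ×
  AllPairs (λ { (_ , e) (_ , e') → e ≢ e' }) A

LKHalfRef : ℕ → CNF → ℕ → Set
LKHalfRef k F s = Σ (Refutation F) λ π → IsLKHalf k π × refSize π ≤ s

LKDTRef : ℕ → CNF → ℕ → Set
LKDTRef k F s =
  Σ (List Extension) λ A → Σ (Refutation (F ++ extAxioms A)) λ π →
    ValidExt F ⌊log₂ refSize π ⌋ A × IsLK k π × refSize π ≤ s

qpoly : ℕ → ℕ → ℕ
qpoly c s = 2 ^ ((suc ⌊log₂ s ⌋) ^ c)

{-# OPTIONS --safe #-}
module Submission where

-- From LK_{k+½} to LK_k with extension axioms: every depth-1 subformula of an LK_{k+½}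
-- refutation of size s is a conjunction or disjunction of at most log s literals.  Replace
-- ⋀ ℓ₁…ℓₘ by an extension variable e defined by the depth-m decision tree that accepts exactly
-- ℓ₁ ∧ … ∧ ℓₘ, and ⋁ ℓ₁…ℓₘ by ¬e for the term ¬ℓ₁ ∧ … ∧ ¬ℓₘ.  This lowers the depth by one, and
-- the ∧- and ∨-introductions of such formulas are re-derived from the extension axioms by m cuts.
--
-- Conversely, given extension axioms for trees of depth at most log s, replace each literal by
-- the disjunction of the terms of the accepting paths of its tree (an original variable x having
-- the tree that just queries x).  Every depth-1 subformula then has size at most log s + 2, the
-- depth grows by at most one, each extension axiom ¬b ∨ e becomes a weakening of b ∨ ¬b, and a
-- cut on a literal becomes at most s cuts on path terms; the negation of a rejecting path is
-- derived from the accepting ones, each of which clashes with it.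
--
-- Either way every inference costs poly(s) lines of size poly(s); padding with empty lines makes
-- the logarithm of the new size large enough, and the total size 2^O(log s) is below qpoly 9 s.

open import Defs
open import Data.Nat
open import Data.Bool using (Bool; true; false; not; _∧_; _∨_)
open import Data.Bool.Properties using (not-involutive) renaming (_≟_ to _≟ᵇ_)
open import Data.Empty using (⊥-elim)
open import Data.List using (List; []; _∷_; _++_; map; concatMap; length; replicate)
open import Data.List.Properties using (map-++; length-map; length-++; ++-assoc; ++-identityʳ; ≡-dec)
open import Data.List.Membership.Propositional using (_∈_; find; lose)
open import Data.List.Membership.DecPropositional _≟_ using (_∈?_)
open import Data.List.Membership.Propositional.Properties
  using (∈-++⁺ˡ; ∈-++⁺ʳ; ∈-++⁻; ∈-map⁺; ∈-map⁻; ∈-concatMap⁺; ∈-concatMap⁻)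
open import Data.List.Relation.Binary.Subset.Propositional using (_⊆_)
open import Data.List.Relation.Binary.Subset.Propositional.Properties
  using (⊆-refl; ⊆-trans; xs⊆xs++ys; xs⊆ys++xs; ∷⁺ʳ; ∈-∷⁺ʳ; ++⁺ˡ; ++⁺ʳ; Any-resp-⊆)
  renaming (map⁺ to ⊆-map⁺)
open import Data.List.Relation.Unary.All as All using (All; []; _∷_)
open import Data.List.Relation.Unary.All.Properties using (++⁺; ++⁻ʳ) renaming (map⁺ to All-map⁺; map⁻ to All-map⁻)
open import Data.List.Relation.Unary.AllPairs using (AllPairs; []; _∷_)
open import Data.List.Relation.Unary.Any as Any using (Any; here; there; any?)
import Data.List.Relation.Unary.Any.Properties as Any
open import Data.Maybe using (Maybe; just; nothing)
import Data.Maybe as Maybe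
open import Data.Nat.ListAction using (sum)
open import Data.Nat.Properties
open import Data.Nat.Solver using (module +-*-Solver)
open import Data.Nat.Logarithm using (⌊log₂_⌋; ⌊log₂⌋-mono-≤; ⌊log₂[2^n]⌋≡n; ⌊log₂[2*b]⌋≡1+⌊log₂b⌋)
open import Data.Product using (Σ; _×_; _,_; proj₁; proj₂; ∃-syntax)
open import Data.Sum using (_⊎_; inj₁; inj₂)
open import Function using (_∘_)
open import Relation.Binary using (DecidableEquality)
open import Relation.Binary.PropositionalEquality
  using (_≡_; _≢_; refl; sym; trans; cong; cong₂; subst; module ≡-Reasoning)
open import Relation.Nullary using (Dec; yes; no; ¬_)

⊆-++⁻ : ∀ {A : Set} {xs ys zs : List A} → xs ⊆ zs → ys ⊆ zs → xs ++ ys ⊆ zs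
⊆-++⁻ {xs = xs} xs⊆ ys⊆ v∈ with ∈-++⁻ xs v∈
... | inj₁ v∈xs = xs⊆ v∈xs
... | inj₂ v∈ys = ys⊆ v∈ys

[]⊆ : ∀ {A : Set} {xs : List A} → [] ⊆ xs
[]⊆ ()

∈-concatMap⁺′ : ∀ {A B : Set} (f : A → List B) {xs x y} → x ∈ xs → y ∈ f x → y ∈ concatMap f xs
∈-concatMap⁺′ f x∈ y∈ = ∈-concatMap⁺ f (lose x∈ y∈)

∈-concatMap⁻′ : ∀ {A B : Set} (f : A → List B) xs {y} → y ∈ concatMap f xs → ∃[ x ] x ∈ xs × y ∈ f x
∈-concatMap⁻′ f xs y∈ = find (∈-concatMap⁻ f y∈)

++-∷⊆∷-++ : ∀ {A : Set} (xs : List A) a ys → xs ++ a ∷ ys ⊆ a ∷ xs ++ ys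
++-∷⊆∷-++ xs a ys = ⊆-++⁻ (⊆-trans (xs⊆xs++ys xs ys) there) (∈-∷⁺ʳ (here refl) (⊆-trans (xs⊆ys++xs ys xs) there))

∷-++⊆++-∷ : ∀ {A : Set} (xs : List A) a ys → a ∷ xs ++ ys ⊆ xs ++ a ∷ ys
∷-++⊆++-∷ xs a ys = ∈-∷⁺ʳ (∈-++⁺ʳ xs (here refl)) (⊆-++⁻ (xs⊆xs++ys xs _) (⊆-trans there (xs⊆ys++xs _ xs)))

∈⇒≤sum : ∀ {n} ns → n ∈ ns → n ≤ sum ns
∈⇒≤sum (n ∷ ns) (here refl) = m≤m+n n (sum ns)
∈⇒≤sum (m ∷ ns) (there n∈) = ≤-trans (∈⇒≤sum ns n∈) (m≤n+m _ m)

negLit-involutive : ∀ l → negLit (negLit l) ≡ l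
negLit-involutive (pos x) = refl
negLit-involutive (neg x) = refl

map-negLit-involutive : ∀ ls → map negLit (map negLit ls) ≡ ls
map-negLit-involutive [] = refl
map-negLit-involutive (l ∷ ls) = cong₂ _∷_ (negLit-involutive l) (map-negLit-involutive ls)

var-negLit : ∀ l → var (negLit l) ≡ var l
var-negLit (pos x) = refl
var-negLit (neg x) = refl

_≟ₗ_ : DecidableEquality Literal
pos x ≟ₗ pos y with x ≟ y
... | yes refl = yes refl
... | no x≢y = no λ { refl → x≢y refl }
pos x ≟ₗ neg y = no λ ()
neg x ≟ₗ pos y = no λ ()
neg x ≟ₗ neg y with x ≟ y
... | yes refl = yes refl
... | no x≢y = no λ { refl → x≢y refl }

sizeL-++ : ∀ fs gs → sizeL (fs ++ gs) ≡ sizeL fs + sizeL gs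
sizeL-++ [] gs = refl
sizeL-++ (f ∷ fs) gs = trans (cong (size f +_) (sizeL-++ fs gs)) (sym (+-assoc (size f) _ _))

sizeL-map-lit : ∀ ls → sizeL (map lit ls) ≡ length ls
sizeL-map-lit [] = refl
sizeL-map-lit (l ∷ ls) = cong suc (sizeL-map-lit ls)

depthL-map-lit : ∀ ls → depthL (map lit ls) ≡ 0
depthL-map-lit [] = refl
depthL-map-lit (l ∷ ls) = depthL-map-lit ls

length≤sizeL : ∀ fs → length fs ≤ sizeL fs
length≤sizeL [] = z≤n
length≤sizeL (lit _ ∷ fs) = s≤s (length≤sizeL fs)
length≤sizeL (⋀ gs ∷ fs) = s≤s (≤-trans (length≤sizeL fs) (m≤n+m _ _))
length≤sizeL (⋁ gs ∷ fs) = s≤s (≤-trans (length≤sizeL fs) (m≤n+m _ _))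

cedentSize-map-lit-++ : ∀ ls Δ → cedentSize (map lit ls ++ Δ) ≡ length ls + cedentSize Δ
cedentSize-map-lit-++ ls Δ = begin
  suc (sizeL (map lit ls ++ Δ))        ≡⟨ cong suc (sizeL-++ (map lit ls) Δ) ⟩
  suc (sizeL (map lit ls) + sizeL Δ)   ≡⟨ cong (λ n → suc (n + sizeL Δ)) (sizeL-map-lit ls) ⟩
  suc (length ls + sizeL Δ)            ≡⟨ sym (+-suc (length ls) (sizeL Δ)) ⟩
  length ls + cedentSize Δ             ∎
  where open ≡-Reasoning

All⇒depthL≤ : ∀ {k} fs → All (λ f → depth f ≤ k) fs → depthL fs ≤ k
All⇒depthL≤ [] [] = z≤n
All⇒depthL≤ (f ∷ fs) (p ∷ ps) = ⊔-lub p (All⇒depthL≤ fs ps)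

depthL≤⇒All : ∀ {k} fs → depthL fs ≤ k → All (λ f → depth f ≤ k) fs
depthL≤⇒All [] p = []
depthL≤⇒All (f ∷ fs) p =
  m⊔n≤o⇒m≤o (depth f) (depthL fs) p ∷ depthL≤⇒All fs (m⊔n≤o⇒n≤o (depth f) (depthL fs) p)

All-lit-depth≤ : ∀ {k} ls → All (λ f → depth f ≤ k) (map lit ls)
All-lit-depth≤ [] = []
All-lit-depth≤ (l ∷ ls) = z≤n ∷ All-lit-depth≤ ls

dualL-map-lit : ∀ ls → dualL (map lit ls) ≡ map lit (map negLit ls)
dualL-map-lit [] = refl
dualL-map-lit (l ∷ ls) = cong (lit (negLit l) ∷_) (dualL-map-lit ls)

dualL-++ : ∀ fs gs → dualL (fs ++ gs) ≡ dualL fs ++ dualL gs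
dualL-++ [] gs = refl
dualL-++ (f ∷ fs) gs = cong (dual f ∷_) (dualL-++ fs gs)

var∈vars : ∀ {F C l} → C ∈ F → l ∈ C → var l ∈ vars F
var∈vars C∈ l∈ = ∈-concatMap⁺′ (map var) C∈ (∈-map⁺ var l∈)

∈-extAxioms : ∀ {T e br} A → (T , e) ∈ A → br ∈ branches T → branchAxiom e br ∈ extAxioms A
∈-extAxioms ((T , e) ∷ A) (here refl) br∈ = ∈-++⁺ˡ (∈-map⁺ (branchAxiom e) br∈)
∈-extAxioms ((T′ , e′) ∷ A) (there Te∈) br∈ = ∈-++⁺ʳ (extAxiom T′ e′) (∈-extAxioms A Te∈ br∈)

∈-extAxioms⁻ : ∀ A {C} → C ∈ extAxioms A →
               ∃[ T ] ∃[ e ] (T , e) ∈ A × ∃[ br ] br ∈ branches T × C ≡ branchAxiom e br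
∈-extAxioms⁻ ((T , e) ∷ A) C∈ with ∈-++⁻ (extAxiom T e) C∈
... | inj₁ C∈T with ∈-map⁻ (branchAxiom e) C∈T
...   | br , br∈ , C≡ = T , e , here refl , br , br∈ , C≡
∈-extAxioms⁻ ((T , e) ∷ A) C∈ | inj₂ C∈A with ∈-extAxioms⁻ A C∈A
...   | T′ , e′ , Te∈ , rest = T′ , e′ , there Te∈ , rest

[]∉extAxioms : ∀ A → ¬ ([] ∈ extAxioms A)
[]∉extAxioms A []∈ with ∈-extAxioms⁻ A []∈
... | _ , _ , _ , (_ ∷ _ , true) , _ , ()
... | _ , _ , _ , (_ ∷ _ , false) , _ , ()
... | _ , _ , _ , ([] , true) , _ , ()
... | _ , _ , _ , ([] , false) , _ , ()

[]∈? : (F : CNF) → Dec ([] ∈ F)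
[]∈? [] = no λ ()
[]∈? ([] ∷ F) = yes (here refl)
[]∈? ((l ∷ C) ∷ F) with []∈? F
... | yes []∈ = yes (there []∈)
... | no []∉ = no λ { (here ()) ; (there []∈) → []∉ []∈ }

vars≡[]⇒≡[] : ∀ F → vars F ≡ [] → ¬ ([] ∈ F) → F ≡ []
vars≡[]⇒≡[] [] _ _ = refl
vars≡[]⇒≡[] ([] ∷ F) _ []∉ = ⊥-elim ([]∉ (here refl))
vars≡[]⇒≡[] ((l ∷ C) ∷ F) () _

-- Soundness for the all-true assignment

evalLit : Literal → Bool
evalLit (pos _) = true
evalLit (neg _) = false

mutual
  eval : Formula → Bool
  eval (lit l) = evalLit l
  eval (⋀ fs) = evalAll fs
  eval (⋁ fs) = evalAny fs

  evalAll : List Formula → Bool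
  evalAll [] = true
  evalAll (f ∷ fs) = eval f ∧ evalAll fs

  evalAny : List Formula → Bool
  evalAny [] = false
  evalAny (f ∷ fs) = eval f ∨ evalAny fs

mutual
  eval-dual : ∀ f → eval (dual f) ≡ not (eval f)
  eval-dual (lit (pos x)) = refl
  eval-dual (lit (neg x)) = refl
  eval-dual (⋀ fs) = evalAny-dualL fs
  eval-dual (⋁ fs) = evalAll-dualL fs

  evalAny-dualL : ∀ fs → evalAny (dualL fs) ≡ not (evalAll fs)
  evalAny-dualL [] = refl
  evalAny-dualL (f ∷ fs) with eval f | eval-dual f
  ... | true | e = trans (cong (_∨ _) e) (evalAny-dualL fs)
  ... | false | e = cong (_∨ _) e

  evalAll-dualL : ∀ fs → evalAll (dualL fs) ≡ not (evalAny fs)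
  evalAll-dualL [] = refl
  evalAll-dualL (f ∷ fs) with eval f | eval-dual f
  ... | true | e = cong (_∧ _) e
  ... | false | e = trans (cong (_∧ _) e) (evalAll-dualL fs)

Holds : Formula → Set
Holds f = eval f ≡ true

Any-Holds⇒evalAny : ∀ fs → Any Holds fs → evalAny fs ≡ true
Any-Holds⇒evalAny (f ∷ fs) (here f-holds) rewrite f-holds = refl
Any-Holds⇒evalAny (f ∷ fs) (there a) with eval f
... | true = refl
... | false = Any-Holds⇒evalAny fs a

All-Holds⇒evalAll : ∀ fs → All Holds fs → evalAll fs ≡ true
All-Holds⇒evalAll [] [] = refl
All-Holds⇒evalAll (f ∷ fs) (f-holds ∷ a) rewrite f-holds = All-Holds⇒evalAll fs a

inference-sound : ∀ {prev Γ} → Inference [] prev Γ → All (Any Holds) prev → Any Holds Γ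
inference-sound (axiom p) _ = here refl
inference-sound (hyp ()) _
inference-sound (weak Γ∈ Γ⊆) h = Any-resp-⊆ Γ⊆ (All.lookup h Γ∈)
inference-sound (∧-intro Γ fs prems) h with any? (λ f → eval f ≟ᵇ true) Γ
... | yes a = there a
... | no ¬a = here (All-Holds⇒evalAll fs (All.map premise-holds prems))
  where
  premise-holds : ∀ {f} → (f ∷ Γ) ∈ _ → Holds f
  premise-holds f∷Γ∈ with All.lookup h f∷Γ∈
  ... | here f-holds = f-holds
  ... | there a = ⊥-elim (¬a a)
inference-sound (∨-intro Γ fs prem) h with Any.++⁻ fs (All.lookup h prem)
... | inj₁ a = here (Any-Holds⇒evalAny fs a)
... | inj₂ a = there a
inference-sound (cut Γ A A∷Γ∈ dualA∷Γ∈) h with All.lookup h A∷Γ∈ | All.lookup h dualA∷Γ∈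
... | there a | _ = a
... | here _ | there a = a
... | here A-holds | here dualA-holds with trans (sym dualA-holds) (trans (eval-dual A) (cong not A-holds))
...   | ()

derivation-sound : ∀ {ls} → Derivation [] ls → All (Any Holds) ls
derivation-sound [] = []
derivation-sound (D ▷ inf) = inference-sound inf (derivation-sound D) ∷ derivation-sound D

no-refutation-of-[] : ¬ Refutation []
no-refutation-of-[] (refutation _ D) with All.head (derivation-sound D)
... | ()

proofSize≤length* : ∀ {M} ls → All (λ Γ → cedentSize Γ ≤ M) ls → proofSize ls ≤ length ls * M
proofSize≤length* [] [] = z≤n
proofSize≤length* (Γ ∷ ls) (p ∷ ps) = +-mono-≤ p (proofSize≤length* ls ps)

length≤proofSize : ∀ ls → length ls ≤ proofSize ls
length≤proofSize [] = z≤n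
length≤proofSize (Γ ∷ ls) = +-mono-≤ (s≤s z≤n) (length≤proofSize ls)

cedentSize≤proofSize : ∀ {Γ} ls → Γ ∈ ls → cedentSize Γ ≤ proofSize ls
cedentSize≤proofSize (Γ ∷ ls) (here refl) = m≤m+n _ _
cedentSize≤proofSize (Γ ∷ ls) (there Γ∈) = ≤-trans (cedentSize≤proofSize ls Γ∈) (m≤n+m _ _)

first-line≡[]⇒[]∈ : ∀ {Ax Γ} → Inference Ax [] Γ → Γ ≡ [] → [] ∈ Ax
first-line≡[]⇒[]∈ (hyp {[]} C∈) _ = C∈
first-line≡[]⇒[]∈ (hyp {_ ∷ _} _) ()
first-line≡[]⇒[]∈ (weak () _) _
first-line≡[]⇒[]∈ (cut _ _ () _) _

2≤refSize : ∀ {Ax} (π : Refutation Ax) → ¬ ([] ∈ Ax) → 2 ≤ refSize π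
2≤refSize (refutation [] ([] ▷ inf)) []∉ = ⊥-elim ([]∉ (first-line≡[]⇒[]∈ inf refl))
2≤refSize (refutation (_ ∷ _) _) _ = s≤s (s≤s z≤n)

-- Padding with p empty lines lets the new refutation be as large as the logarithmic
-- bounds (which refer to its own size) require.
padded : ∀ {Ax ls} → Derivation Ax ls → (∃[ Γ ] Γ ∈ ls × Γ ⊆ []) → ∀ p →
         Derivation Ax ([] ∷ (replicate p [] ++ ls))
padded D (Γ , Γ∈ , Γ⊆) zero = D ▷ weak Γ∈ Γ⊆
padded D d (suc p) = padded D d p ▷ weak (here refl) ⊆-refl

∈-padded : ∀ {Γ : Cedent} p ls → Γ ∈ ([] ∷ (replicate p [] ++ ls)) → Γ ≡ [] ⊎ Γ ∈ ls
∈-padded p ls (here refl) = inj₁ refl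
∈-padded zero ls (there Γ∈) = inj₂ Γ∈
∈-padded (suc p) ls (there Γ∈) = ∈-padded p ls Γ∈

proofSize-padded : ∀ p ls → proofSize ([] ∷ (replicate p [] ++ ls)) ≡ suc (p + proofSize ls)
proofSize-padded zero ls = refl
proofSize-padded (suc p) ls = cong suc (proofSize-padded p ls)

-- Allowed carries the depth and size bounds of the target system; every line a Builds adds
-- satisfies it, so the final refutation meets the bounds by construction.
module Building (Ax : CNF) (Allowed : Cedent → Set) where

  Derivable : List Cedent → Cedent → Set
  Derivable ls Δ = ∃[ Γ ] Γ ∈ ls × Γ ⊆ Δ

  Derivable-mono : ∀ {ls ls′ Δ} → ls ⊆ ls′ → Derivable ls Δ → Derivable ls′ Δ
  Derivable-mono ls⊆ (Γ , Γ∈ , Γ⊆) = Γ , ls⊆ Γ∈ , Γ⊆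

  Derivable-weaken : ∀ {ls Δ Δ′} → Δ ⊆ Δ′ → Derivable ls Δ → Derivable ls Δ′
  Derivable-weaken Δ⊆ (Γ , Γ∈ , Γ⊆) = Γ , Γ∈ , ⊆-trans Γ⊆ Δ⊆

  Derivable-line : ∀ {ls Δ} → Δ ∈ ls → Derivable ls Δ
  Derivable-line Δ∈ = _ , Δ∈ , ⊆-refl

  Derivable-resp : ∀ {ls A A′ Δ} → A ≡ A′ → Derivable ls (A ∷ Δ) → Derivable ls (A′ ∷ Δ)
  Derivable-resp refl d = d

  record Extended (ls : List Cedent) (n : ℕ) (R : List Cedent → Set) : Set where
    constructor extended
    field
      lines′     : List Cedent
      derivation : Derivation Ax lines′
      extends    : ls ⊆ lines′
      allowed    : All Allowed lines′
      length≤    : length lines′ ≤ n + length ls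
      result     : R lines′

  Builds : List Cedent → ℕ → (List Cedent → Set) → Set
  Builds ls n R = Derivation Ax ls → All Allowed ls → Extended ls n R

  Monotone : (List Cedent → Set) → Set
  Monotone R = ∀ {ls ls′} → ls ⊆ ls′ → R ls → R ls′

  return : ∀ {ls R} → R ls → Builds ls 0 R
  return r D q = extended _ D ⊆-refl q ≤-refl r

  infixr 1 _>>=_
  _>>=_ : ∀ {ls n m R S} → Builds ls n R → (∀ {ls′} → ls ⊆ ls′ → R ls′ → Builds ls′ m S) → Builds ls (n + m) S
  _>>=_ {ls} {n} {m} b k D q with b D q
  ... | extended l₁ D₁ s₁ q₁ len₁ r₁ with k s₁ r₁ D₁ q₁
  ... | extended l₂ D₂ s₂ q₂ len₂ r₂ = extended l₂ D₂ (⊆-trans s₁ s₂) q₂ len r₂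
    where
    len : length l₂ ≤ (n + m) + length ls
    len = begin
      length l₂               ≤⟨ len₂ ⟩
      m + length l₁           ≤⟨ +-monoʳ-≤ m len₁ ⟩
      m + (n + length ls)     ≡⟨ sym (+-assoc m n _) ⟩
      (m + n) + length ls     ≡⟨ cong (_+ length ls) (+-comm m n) ⟩
      (n + m) + length ls     ∎
      where open ≤-Reasoning

  within : ∀ {ls n m R} → n ≤ m → Builds ls n R → Builds ls m R
  within n≤m b D q with b D q
  ... | extended l D′ s q′ len r = extended l D′ s q′ (≤-trans len (+-monoˡ-≤ _ n≤m)) r

  map-result : ∀ {ls n R S} → (∀ {l} → R l → S l) → Builds ls n R → Builds ls n S
  map-result f b D q with b D q
  ... | extended l D′ s q′ len r = extended l D′ s q′ len (f r)

  keeping : ∀ {ls n R S} → Monotone S → S ls → Builds ls n R → Builds ls n (λ l → R l × S l)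
  keeping mono-S s b D q with b D q
  ... | extended l D′ ls⊆ q′ len r = extended l D′ ls⊆ q′ len (r , mono-S ls⊆ s)

  infer : ∀ {ls Γ} → Inference Ax ls Γ → Allowed Γ → Builds ls 1 (λ l → Derivable l Γ)
  infer inf okΓ D q = extended _ (D ▷ inf) there (okΓ ∷ q) ≤-refl (Derivable-line (here refl))

  as-line : ∀ {ls Γ} → Derivable ls Γ → Allowed Γ → Builds ls 1 (λ l → Γ ∈ l)
  as-line (Γ′ , Γ′∈ , Γ′⊆) okΓ D q = extended _ (D ▷ weak Γ′∈ Γ′⊆) there (okΓ ∷ q) ≤-refl (here refl)

  axiom-line : ∀ {ls} p → Allowed (lit (pos p) ∷ lit (neg p) ∷ []) →
               Builds ls 1 (λ l → Derivable l (lit (pos p) ∷ lit (neg p) ∷ []))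
  axiom-line p = infer (axiom p)

  hyp-line : ∀ {ls C} → C ∈ Ax → Allowed (clauseCedent C) → Builds ls 1 (λ l → Derivable l (clauseCedent C))
  hyp-line C∈ = infer (hyp C∈)

  cut-on : ∀ {ls} A Δ → Derivable ls (A ∷ Δ) → Derivable ls (dual A ∷ Δ) →
           Allowed (A ∷ Δ) → Allowed (dual A ∷ Δ) → Allowed Δ → Builds ls 3 (λ l → Derivable l Δ)
  cut-on A Δ d₁ d₂ ok₁ ok₂ ok =
    as-line d₁ ok₁ >>= λ s₁ A∷Δ∈ →
    as-line (Derivable-mono s₁ d₂) ok₂ >>= λ s₂ dualA∷Δ∈ →
    infer (cut Δ A (s₂ A∷Δ∈) dualA∷Δ∈) ok

  ∨-intro-on : ∀ {ls} Δ fs → Derivable ls (fs ++ Δ) → Allowed (fs ++ Δ) → Allowed (⋁ fs ∷ Δ) →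
               Builds ls 2 (λ l → Derivable l (⋁ fs ∷ Δ))
  ∨-intro-on Δ fs d ok₁ ok = as-line d ok₁ >>= λ _ fs++Δ∈ → infer (∨-intro Δ fs fs++Δ∈) ok

  for-each : ∀ {X : Set} {ls n} (xs : List X) (P : X → List Cedent → Set) → (∀ x → Monotone (P x)) →
             (∀ {l} x → x ∈ xs → ls ⊆ l → Builds l n (P x)) →
             Builds ls (length xs * n) (λ l → All (λ x → P x l) xs)
  for-each [] P mono f = return []
  for-each (x ∷ xs) P mono f =
    f x (here refl) ⊆-refl >>= λ s₁ p →
    map-result (λ { (ps , p′) → p′ ∷ ps })
      (keeping (mono x) p (for-each xs P mono (λ y y∈ s₂ → f y (there y∈) (⊆-trans s₁ s₂))))

  ∧-intro-on : ∀ {ls} Δ fs → All (λ f → Derivable ls (f ∷ Δ)) fs → All (λ f → Allowed (f ∷ Δ)) fs →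
               Allowed (⋀ fs ∷ Δ) → Builds ls (length fs * 1 + 1) (λ l → Derivable l (⋀ fs ∷ Δ))
  ∧-intro-on Δ fs ds oks ok =
    for-each fs (λ f l → (f ∷ Δ) ∈ l) (λ f s f∷Δ∈ → s f∷Δ∈)
      (λ f f∈ s → as-line (Derivable-mono s (All.lookup ds f∈)) (All.lookup oks f∈)) >>= λ _ prems →
    infer (∧-intro Δ fs prems) ok

  Simulated : (Cedent → Cedent) → List Cedent → List Cedent → Set
  Simulated tr ls l = ∀ {Γ} → Γ ∈ ls → Derivable l (tr Γ)

  Simulated-mono : ∀ tr ls → Monotone (Simulated tr ls)
  Simulated-mono tr ls l⊆ sim Γ∈ = Derivable-mono l⊆ (sim Γ∈)

  simulate : ∀ {Src Lπ} (tr : Cedent → Cedent) {C} →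
             (∀ {prev Γ l} → Inference Src prev Γ → prev ⊆ Lπ → Γ ∈ Lπ →
                Simulated tr prev l → Builds l C (λ l′ → Derivable l′ (tr Γ))) →
             ∀ {ls} → Derivation Src ls → ls ⊆ Lπ → Builds [] (length ls * C) (Simulated tr ls)
  simulate tr step [] _ = return λ ()
  simulate tr {C} step {Γ ∷ ls} (D ▷ inf) ls⊆ =
    within (≤-reflexive (+-comm (length ls * C) C))
      (simulate tr step D (ls⊆ ∘ there) >>= λ _ earlier →
       map-result (λ { (d , earlier′) → λ { (here refl) → d ; (there Γ∈) → earlier′ Γ∈ } })
         (keeping (Simulated-mono tr ls) earlier (step inf (ls⊆ ∘ there) (ls⊆ (here refl)) earlier)))

  refutation-from : ∀ {n} → Extended [] n (λ l → Derivable l []) → ℕ → Refutation Ax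
  refutation-from e p = refutation (replicate p [] ++ lines′) (padded derivation result p)
    where open Extended e

  refSize-refutation-from : ∀ {n} (e : Extended [] n (λ l → Derivable l [])) p →
                            refSize (refutation-from e p) ≡ suc (p + proofSize (Extended.lines′ e))
  refSize-refutation-from e p = proofSize-padded p (Extended.lines′ e)

  formula-of-refutation-from : ∀ {n} (e : Extended [] n (λ l → Derivable l [])) p {P : Formula → Set} →
                               (∀ {Γ f} → Allowed Γ → f ∈ Γ → P f) →
                               ∀ {Γ f} → Γ ∈ lines (refutation-from e p) → f ∈ Γ → P f
  formula-of-refutation-from e p allowed⇒P Γ∈ f∈ with ∈-padded p (Extended.lines′ e) Γ∈ | f∈
  ... | inj₁ refl | ()
  ... | inj₂ Γ∈′ | _ = allowed⇒P (All.lookup (Extended.allowed e) Γ∈′) f∈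

<2^suc⌊log₂⌋ : ∀ n → n < 2 ^ suc ⌊log₂ n ⌋
<2^suc⌊log₂⌋ n with n <? 2 ^ suc ⌊log₂ n ⌋
... | yes n< = n<
... | no n≮ = ⊥-elim (1+n≰n (begin
  suc ⌊log₂ n ⌋                    ≡⟨ sym (⌊log₂[2^n]⌋≡n (suc ⌊log₂ n ⌋)) ⟩
  ⌊log₂ 2 ^ suc ⌊log₂ n ⌋ ⌋        ≤⟨ ⌊log₂⌋-mono-≤ (≮⇒≥ n≮) ⟩
  ⌊log₂ n ⌋                        ∎))
  where open ≤-Reasoning

1≤⌊log₂⌋ : ∀ {n} → 2 ≤ n → 1 ≤ ⌊log₂ n ⌋
1≤⌊log₂⌋ 2≤n = ≤-trans (≤-reflexive (sym (⌊log₂[2^n]⌋≡n 1))) (⌊log₂⌋-mono-≤ 2≤n)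

n<2^n : ∀ n → n < 2 ^ n
n<2^n zero = s≤s z≤n
n<2^n (suc n) = begin-strict
  suc n              <⟨ s≤s (n<2^n n) ⟩
  suc (2 ^ n)        ≤⟨ +-monoˡ-≤ (2 ^ n) (m^n>0 2 n) ⟩
  2 ^ n + 2 ^ n      ≡⟨ cong (2 ^ n +_) (sym (+-identityʳ _)) ⟩
  2 ^ suc n          ∎
  where open ≤-Reasoning

-- The exponent 9 absorbs any j ≤ 2⁸ ≤ L⁸ for L = 1 + ⌊log₂ s⌋ ≥ 2.
≤qpoly9 : ∀ s x j → 2 ≤ s → j ≤ 256 → x ≤ (2 ^ suc ⌊log₂ s ⌋) ^ j → x ≤ qpoly 9 s
≤qpoly9 s x j 2≤s j≤256 x≤ = begin
  x                 ≤⟨ x≤ ⟩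
  (2 ^ L) ^ j       ≡⟨ ^-*-assoc 2 L j ⟩
  2 ^ (L * j)       ≤⟨ ^-monoʳ-≤ 2 (*-monoʳ-≤ L (≤-trans j≤256 (^-monoˡ-≤ 8 2≤L))) ⟩
  2 ^ (L * L ^ 8)   ∎
  where
  open ≤-Reasoning
  L = suc ⌊log₂ s ⌋
  2≤L : 2 ≤ L
  2≤L = s≤s (1≤⌊log₂⌋ 2≤s)

module PowerBounds (P : ℕ) (2≤P : 2 ≤ P) where

  instance
    P-nonZero : NonZero P
    P-nonZero = >-nonZero (≤-trans (s≤s z≤n) 2≤P)

  ≤P^1 : ∀ {x} → x ≤ P → x ≤ P ^ 1
  ≤P^1 x≤P = ≤-trans x≤P (≤-reflexive (sym (*-identityʳ P)))

  ≤P^-mono : ∀ {x a b} → x ≤ P ^ a → a ≤ b → x ≤ P ^ b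
  ≤P^-mono x≤ a≤b = ≤-trans x≤ (^-monoʳ-≤ P a≤b)

  +-≤P^ : ∀ {x y a} → x ≤ P ^ a → y ≤ P ^ a → x + y ≤ P ^ suc a
  +-≤P^ {x} {y} {a} x≤ y≤ = begin
    x + y              ≤⟨ +-mono-≤ x≤ y≤ ⟩
    P ^ a + P ^ a      ≡⟨ cong (P ^ a +_) (sym (+-identityʳ _)) ⟩
    2 * P ^ a          ≤⟨ *-monoˡ-≤ (P ^ a) 2≤P ⟩
    P ^ suc a          ∎
    where open ≤-Reasoning

  *-≤P^ : ∀ {x y a b} → x ≤ P ^ a → y ≤ P ^ b → x * y ≤ P ^ (a + b)
  *-≤P^ {a = a} {b} x≤ y≤ = ≤-trans (*-mono-≤ x≤ y≤) (≤-reflexive (sym (^-distribˡ-+-* P a b)))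

-- From LK_{k+½} to LK_k with shallow decision trees

literals? : List Formula → Maybe (List Literal)
literals? [] = just []
literals? (lit l ∷ fs) = Maybe.map (l ∷_) (literals? fs)
literals? (⋀ _ ∷ _) = nothing
literals? (⋁ _ ∷ _) = nothing

literals?≡just : ∀ fs {ls} → literals? fs ≡ just ls → fs ≡ map lit ls
literals?≡just [] refl = refl
literals?≡just (lit l ∷ fs) eq with literals? fs in eq′
literals?≡just (lit l ∷ fs) refl | just ls = cong (lit l ∷_) (literals?≡just fs eq′)

literals?≡nothing : ∀ fs → literals? fs ≡ nothing → 1 ≤ depthL fs
literals?≡nothing (lit l ∷ fs) eq with literals? fs in eq′
literals?≡nothing (lit l ∷ fs) eq | nothing = literals?≡nothing fs eq′
literals?≡nothing (⋀ gs ∷ fs) _ = ≤-trans (s≤s z≤n) (m≤m⊔n (suc (depthL gs)) (depthL fs))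
literals?≡nothing (⋁ gs ∷ fs) _ = ≤-trans (s≤s z≤n) (m≤m⊔n (suc (depthL gs)) (depthL fs))

literals?-dualL : ∀ fs → literals? (dualL fs) ≡ Maybe.map (map negLit) (literals? fs)
literals?-dualL [] = refl
literals?-dualL (lit l ∷ fs) with literals? fs | literals?-dualL fs
... | just ls | ih = cong (Maybe.map (negLit l ∷_)) ih
... | nothing | ih = cong (Maybe.map (negLit l ∷_)) ih
literals?-dualL (⋀ _ ∷ fs) = refl
literals?-dualL (⋁ _ ∷ fs) = refl

termTree : List Literal → DTree
termTree [] = leaf true
termTree (pos x ∷ ks) = node x (leaf false) (termTree ks)
termTree (neg x ∷ ks) = node x (termTree ks) (leaf false)

dtDepth-termTree : ∀ ks → dtDepth (termTree ks) ≡ length ks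
dtDepth-termTree [] = refl
dtDepth-termTree (pos x ∷ ks) = cong suc (dtDepth-termTree ks)
dtDepth-termTree (neg x ∷ ks) = cong suc (trans (⊔-identityʳ _) (dtDepth-termTree ks))

queries-termTree : ∀ {P : ℕ → Set} ks → All (P ∘ var) ks → All P (queries (termTree ks))
queries-termTree [] [] = []
queries-termTree (pos x ∷ ks) (p ∷ ps) = p ∷ queries-termTree ks ps
queries-termTree (neg x ∷ ks) (p ∷ ps) = p ∷ ++⁺ (queries-termTree ks ps) []

termTree-accepts : ∀ ks → (ks , true) ∈ branches (termTree ks)
termTree-accepts [] = here refl
termTree-accepts (pos x ∷ ks) = ∈-++⁺ʳ _ (∈-map⁺ (consLit (pos x)) (termTree-accepts ks))
termTree-accepts (neg x ∷ ks) = ∈-++⁺ˡ (∈-map⁺ (consLit (neg x)) (termTree-accepts ks))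

termTree-rejects : ∀ p κ q → (p ++ negLit κ ∷ [] , false) ∈ branches (termTree (p ++ κ ∷ q))
termTree-rejects [] (pos x) q = here refl
termTree-rejects [] (neg x) q = ∈-++⁺ʳ _ (here refl)
termTree-rejects (pos x ∷ p) κ q = ∈-++⁺ʳ _ (∈-map⁺ (consLit (pos x)) (termTree-rejects p κ q))
termTree-rejects (neg x ∷ p) κ q = ∈-++⁺ˡ (∈-map⁺ (consLit (neg x)) (termTree-rejects p κ q))

indexOf : List Literal → List (List Literal) → ℕ
indexOf ks [] = 0
indexOf ks (ks′ ∷ K) with ≡-dec _≟ₗ_ ks ks′
... | yes _ = 0
... | no _ = suc (indexOf ks K)

termExtensions : List (List Literal) → ℕ → List Extension
termExtensions [] n = []
termExtensions (ks ∷ K) n = (termTree ks , n) ∷ termExtensions K (suc n)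

∈-termExtensions : ∀ {ks} K n → ks ∈ K → (termTree ks , n + indexOf ks K) ∈ termExtensions K n
∈-termExtensions {ks} (ks′ ∷ K) n ks∈ with ≡-dec _≟ₗ_ ks ks′
... | yes refl = here (cong (termTree ks ,_) (+-identityʳ n))
∈-termExtensions {ks} (ks′ ∷ K) n (here refl) | no ks≢ = ⊥-elim (ks≢ refl)
∈-termExtensions {ks} (ks′ ∷ K) n (there ks∈) | no _ =
  there (subst (λ e → (termTree ks , e) ∈ termExtensions K (suc n)) (sym (+-suc n (indexOf ks K)))
               (∈-termExtensions K (suc n) ks∈))

termExtensions-All : ∀ (P : Extension → Set) K n → (∀ ks e → ks ∈ K → n ≤ e → P (termTree ks , e)) →
                     All P (termExtensions K n)
termExtensions-All P [] n h = []
termExtensions-All P (ks ∷ K) n h =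
  h ks n (here refl) ≤-refl ∷
  termExtensions-All P K (suc n) (λ ks′ e ks′∈ n<e → h ks′ e (there ks′∈) (≤-trans (n≤1+n n) n<e))

termExtensions-AllPairs : ∀ (R : Extension → Extension → Set) → (∀ {T e T′ e′} → e ≢ e′ → R (T , e) (T′ , e′)) →
                          ∀ K n → AllPairs R (termExtensions K n)
termExtensions-AllPairs R h [] n = []
termExtensions-AllPairs R h (ks ∷ K) n =
  termExtensions-All (R (termTree ks , n)) K (suc n) (λ _ _ _ n<e → h (<⇒≢ n<e)) ∷
  termExtensions-AllPairs R h K (suc n)

map-++-snoc : ∀ {A B : Set} (f : A → B) xs x → map f (xs ++ x ∷ []) ≡ map f xs ++ f x ∷ []
map-++-snoc f xs x = map-++ f xs (x ∷ [])

snoc-snoc⊆ : ∀ {A : Set} (xs : List A) a b → (xs ++ a ∷ []) ++ b ∷ [] ⊆ a ∷ (xs ++ b ∷ [])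
snoc-snoc⊆ xs a b =
  ⊆-++⁻ (⊆-++⁻ (there ∘ ∈-++⁺ˡ) (∈-∷⁺ʳ (here refl) []⊆)) (∈-∷⁺ʳ (there (∈-++⁺ʳ xs (here refl))) []⊆)

map-lit-⊆-++ : ∀ {xs ys : List Literal} Δ → xs ⊆ ys → map lit xs ++ Δ ⊆ map lit ys ++ Δ
map-lit-⊆-++ Δ xs⊆ = ++⁺ˡ Δ (⊆-map⁺ lit xs⊆)

map-lit-⊆-++ʳ : ∀ {xs ys : List Literal} Δ → xs ⊆ ys → map lit xs ⊆ map lit ys ++ Δ
map-lit-⊆-++ʳ Δ xs⊆ = ⊆-trans (⊆-map⁺ lit xs⊆) (xs⊆xs++ys _ Δ)

module Lowering (F : CNF) (x₀ : ℕ) (x₀∈ : x₀ ∈ vars F) (Lπ : List Cedent) where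

  -- Variables not occurring in F are renamed to x₀, so that the decision trees below
  -- query only variables of F; the clauses of F are unaffected.
  σ : ℕ → ℕ
  σ x with x ∈? vars F
  ... | yes _ = x
  ... | no _ = x₀

  σ∈vars : ∀ x → σ x ∈ vars F
  σ∈vars x with x ∈? vars F
  ... | yes x∈ = x∈
  ... | no _ = x₀∈

  σ-fixed : ∀ {x} → x ∈ vars F → σ x ≡ x
  σ-fixed {x} x∈ with x ∈? vars F
  ... | yes _ = refl
  ... | no x∉ = ⊥-elim (x∉ x∈)

  σL : Literal → Literal
  σL (pos x) = pos (σ x)
  σL (neg x) = neg (σ x)

  σL¬ : Literal → Literal
  σL¬ l = negLit (σL l)

  σL-negLit : ∀ l → σL (negLit l) ≡ negLit (σL l)
  σL-negLit (pos x) = refl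
  σL-negLit (neg x) = refl

  var-σL∈vars : ∀ l → var (σL l) ∈ vars F
  var-σL∈vars (pos x) = σ∈vars x
  var-σL∈vars (neg x) = σ∈vars x

  var-σL¬∈vars : ∀ l → var (σL¬ l) ∈ vars F
  var-σL¬∈vars (pos x) = σ∈vars x
  var-σL¬∈vars (neg x) = σ∈vars x

  σL-fixed : ∀ l → var l ∈ vars F → σL l ≡ l
  σL-fixed (pos x) x∈ = cong pos (σ-fixed x∈)
  σL-fixed (neg x) x∈ = cong neg (σ-fixed x∈)

  map-σL¬-negLit : ∀ ls → map σL¬ (map negLit ls) ≡ map σL ls
  map-σL¬-negLit [] = refl
  map-σL¬-negLit (l ∷ ls) =
    cong₂ _∷_ (trans (cong negLit (σL-negLit l)) (negLit-involutive (σL l))) (map-σL¬-negLit ls)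

  map-σL-negLit : ∀ ls → map σL (map negLit ls) ≡ map σL¬ ls
  map-σL-negLit [] = refl
  map-σL-negLit (l ∷ ls) = cong₂ _∷_ (σL-negLit l) (map-σL-negLit ls)

  map-negLit-σL¬ : ∀ ls → map negLit (map σL¬ ls) ≡ map σL ls
  map-negLit-σL¬ [] = refl
  map-negLit-σL¬ (l ∷ ls) = cong₂ _∷_ (negLit-involutive (σL l)) (map-negLit-σL¬ ls)

  keysOf : Formula → List (List Literal)
  keysOf (lit _) = []
  keysOf (⋀ fs) = Maybe.maybe′ (λ ls → map σL ls ∷ []) [] (literals? fs)
  keysOf (⋁ fs) = Maybe.maybe′ (λ ls → map σL¬ ls ∷ []) [] (literals? fs)

  keys : List (List Literal)
  keys = concatMap (concatMap keysOf) Lπ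

  fresh : ℕ
  fresh = suc (sum (vars F))

  fresh≤⇒∉vars : ∀ {e} → fresh ≤ e → ¬ (e ∈ vars F)
  fresh≤⇒∉vars fresh≤e e∈ = 1+n≰n (≤-trans fresh≤e (∈⇒≤sum (vars F) e∈))

  extVar : List Literal → ℕ
  extVar ks = fresh + indexOf ks keys

  extensions : List Extension
  extensions = termExtensions keys fresh

  -- A depth-1 formula ⋀ ls becomes e_{σ ls} and ⋁ ls becomes ¬e_{¬σ ls}, where e_ks is
  -- the extension variable of termTree ks, which accepts exactly the assignments satisfying ks.
  mutual
    lower : Formula → Formula
    lower (lit l) = lit (σL l)
    lower (⋀ fs) = lower⋀ fs (literals? fs)
    lower (⋁ fs) = lower⋁ fs (literals? fs)

    lower⋀ : List Formula → Maybe (List Literal) → Formula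
    lower⋀ fs (just ls) = lit (pos (extVar (map σL ls)))
    lower⋀ fs nothing = ⋀ (lowerL fs)

    lower⋁ : List Formula → Maybe (List Literal) → Formula
    lower⋁ fs (just ls) = lit (neg (extVar (map σL¬ ls)))
    lower⋁ fs nothing = ⋁ (lowerL fs)

    lowerL : List Formula → List Formula
    lowerL [] = []
    lowerL (f ∷ fs) = lower f ∷ lowerL fs

  lowerL≡map : ∀ fs → lowerL fs ≡ map lower fs
  lowerL≡map [] = refl
  lowerL≡map (f ∷ fs) = cong (lower f ∷_) (lowerL≡map fs)

  lowerL-++ : ∀ fs gs → lowerL (fs ++ gs) ≡ lowerL fs ++ lowerL gs
  lowerL-++ [] gs = refl
  lowerL-++ (f ∷ fs) gs = cong (lower f ∷_) (lowerL-++ fs gs)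

  lowerL-⊆ : ∀ {fs gs} → fs ⊆ gs → lowerL fs ⊆ lowerL gs
  lowerL-⊆ {fs} {gs} fs⊆ rewrite lowerL≡map fs | lowerL≡map gs = ⊆-map⁺ lower fs⊆

  lowerL-map-lit : ∀ ls → lowerL (map lit ls) ≡ map lit (map σL ls)
  lowerL-map-lit [] = refl
  lowerL-map-lit (l ∷ ls) = cong (lit (σL l) ∷_) (lowerL-map-lit ls)

  length-lowerL : ∀ fs → length (lowerL fs) ≡ length fs
  length-lowerL [] = refl
  length-lowerL (f ∷ fs) = cong suc (length-lowerL fs)

  mutual
    lower-dual : ∀ f → lower (dual f) ≡ dual (lower f)
    lower-dual (lit l) = cong lit (σL-negLit l)
    lower-dual (⋀ fs) with literals? fs in eq
    ... | just ls = trans (cong (lower⋁ (dualL fs)) (trans (literals?-dualL fs) (cong (Maybe.map (map negLit)) eq)))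
                          (cong (λ ks → lit (neg (extVar ks))) (map-σL¬-negLit ls))
    ... | nothing = trans (cong (lower⋁ (dualL fs)) (trans (literals?-dualL fs) (cong (Maybe.map (map negLit)) eq)))
                          (cong ⋁ (lowerL-dualL fs))
    lower-dual (⋁ fs) with literals? fs in eq
    ... | just ls = trans (cong (lower⋀ (dualL fs)) (trans (literals?-dualL fs) (cong (Maybe.map (map negLit)) eq)))
                          (cong (λ ks → lit (pos (extVar ks))) (map-σL-negLit ls))
    ... | nothing = trans (cong (lower⋀ (dualL fs)) (trans (literals?-dualL fs) (cong (Maybe.map (map negLit)) eq)))
                          (cong ⋀ (lowerL-dualL fs))

    lowerL-dualL : ∀ fs → lowerL (dualL fs) ≡ dualL (lowerL fs)
    lowerL-dualL [] = refl
    lowerL-dualL (f ∷ fs) = cong₂ _∷_ (lower-dual f) (lowerL-dualL fs)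

  mutual
    size-lower : ∀ f → size (lower f) ≤ size f
    size-lower (lit l) = ≤-refl
    size-lower (⋀ fs) with literals? fs
    ... | just ls = s≤s z≤n
    ... | nothing = s≤s (sizeL-lowerL fs)
    size-lower (⋁ fs) with literals? fs
    ... | just ls = s≤s z≤n
    ... | nothing = s≤s (sizeL-lowerL fs)

    sizeL-lowerL : ∀ fs → sizeL (lowerL fs) ≤ sizeL fs
    sizeL-lowerL [] = z≤n
    sizeL-lowerL (f ∷ fs) = +-mono-≤ (size-lower f) (sizeL-lowerL fs)

  mutual
    depth-lower : ∀ k f → depth f ≤ suc k → depth (lower f) ≤ k
    depth-lower k (lit l) _ = z≤n
    depth-lower k (⋀ fs) d≤ with literals? fs in eq
    ... | just ls = z≤n
    depth-lower zero (⋀ fs) (s≤s d≤) | nothing = ⊥-elim (1+n≰n (≤-trans (literals?≡nothing fs eq) d≤))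
    depth-lower (suc k) (⋀ fs) (s≤s d≤) | nothing =
      s≤s (All⇒depthL≤ (lowerL fs) (All-depth-lowerL k fs (depthL≤⇒All fs d≤)))
    depth-lower k (⋁ fs) d≤ with literals? fs in eq
    ... | just ls = z≤n
    depth-lower zero (⋁ fs) (s≤s d≤) | nothing = ⊥-elim (1+n≰n (≤-trans (literals?≡nothing fs eq) d≤))
    depth-lower (suc k) (⋁ fs) (s≤s d≤) | nothing =
      s≤s (All⇒depthL≤ (lowerL fs) (All-depth-lowerL k fs (depthL≤⇒All fs d≤)))

    All-depth-lowerL : ∀ k fs → All (λ f → depth f ≤ suc k) fs → All (λ f → depth f ≤ k) (lowerL fs)
    All-depth-lowerL k [] [] = []
    All-depth-lowerL k (f ∷ fs) (p ∷ ps) = depth-lower k f p ∷ All-depth-lowerL k fs ps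

  lowerL-clause : ∀ {C} → C ∈ F → lowerL (clauseCedent C) ≡ clauseCedent C
  lowerL-clause {C} C∈ = trans (lowerL-map-lit C) (cong (map lit) (map-σL-fixed C (var∈vars C∈)))
    where
    map-σL-fixed : ∀ D → (∀ {l} → l ∈ D → var l ∈ vars F) → map σL D ≡ D
    map-σL-fixed [] _ = refl
    map-σL-fixed (l ∷ D) vars∈ = cong₂ _∷_ (σL-fixed l (vars∈ (here refl))) (map-σL-fixed D (vars∈ ∘ there))

  ⋀-key∈keys : ∀ {Γ fs ls} → Γ ∈ Lπ → ⋀ fs ∈ Γ → literals? fs ≡ just ls → map σL ls ∈ keys
  ⋀-key∈keys Γ∈ f∈ eq = ∈-concatMap⁺′ (concatMap keysOf) Γ∈
    (∈-concatMap⁺′ keysOf f∈ (subst (λ m → _ ∈ Maybe.maybe′ (λ ls → map σL ls ∷ []) [] m) (sym eq) (here refl)))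

  ⋁-key∈keys : ∀ {Γ fs ls} → Γ ∈ Lπ → ⋁ fs ∈ Γ → literals? fs ≡ just ls → map σL¬ ls ∈ keys
  ⋁-key∈keys Γ∈ f∈ eq = ∈-concatMap⁺′ (concatMap keysOf) Γ∈
    (∈-concatMap⁺′ keysOf f∈ (subst (λ m → _ ∈ Maybe.maybe′ (λ ls → map σL¬ ls ∷ []) [] m) (sym eq) (here refl)))

  extAxiom∈ : ∀ {ks br} → ks ∈ keys → br ∈ branches (termTree ks) → branchAxiom (extVar ks) br ∈ extAxioms extensions
  extAxiom∈ ks∈ br∈ = ∈-extAxioms extensions (∈-termExtensions keys fresh ks∈) br∈

  All-lowerL⁺ : ∀ {P : Formula → Set} {fs} → All (P ∘ lower) fs → All P (lowerL fs)
  All-lowerL⁺ [] = []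
  All-lowerL⁺ (p ∷ ps) = p ∷ All-lowerL⁺ ps

  keysOf-facts : ∀ f {ks} → ks ∈ keysOf f → All (λ κ → var κ ∈ vars F) ks × depth f ≡ 1 × length ks < size f
  keysOf-facts (⋀ fs) ks∈ with literals? fs in eq
  keysOf-facts (⋀ fs) (here refl) | just ls rewrite literals?≡just fs eq =
    All.tabulate var∈ , cong suc (depthL-map-lit ls) , s≤s (≤-reflexive (trans (length-map σL ls) (sym (sizeL-map-lit ls))))
    where
    var∈ : ∀ {κ} → κ ∈ map σL ls → var κ ∈ vars F
    var∈ κ∈ with ∈-map⁻ σL κ∈
    ... | l , _ , refl = var-σL∈vars l
  keysOf-facts (⋁ fs) ks∈ with literals? fs in eq
  keysOf-facts (⋁ fs) (here refl) | just ls rewrite literals?≡just fs eq =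
    All.tabulate var∈ , cong suc (depthL-map-lit ls) , s≤s (≤-reflexive (trans (length-map σL¬ ls) (sym (sizeL-map-lit ls))))
    where
    var∈ : ∀ {κ} → κ ∈ map σL¬ ls → var κ ∈ vars F
    var∈ κ∈ with ∈-map⁻ σL¬ κ∈
    ... | l , _ , refl = var-σL¬∈vars l

  key-origin : ∀ {ks} → ks ∈ keys → ∃[ Γ ] ∃[ f ] Γ ∈ Lπ × f ∈ Γ × ks ∈ keysOf f
  key-origin ks∈ with ∈-concatMap⁻′ (concatMap keysOf) Lπ ks∈
  ... | Γ , Γ∈ , ks∈Γ with ∈-concatMap⁻′ keysOf Γ ks∈Γ
  ...   | f , f∈ , ks∈f = Γ , f , Γ∈ , f∈ , ks∈f

  length-map-negLit-snoc : ∀ ls a → length (map negLit ls ++ a ∷ []) ≡ suc (length ls)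
  length-map-negLit-snoc [] a = refl
  length-map-negLit-snoc (l ∷ ls) a = cong suc (length-map-negLit-snoc ls a)

  module LoweringSimulation (k M : ℕ) (4≤M : 4 ≤ M)
           (depth≤ : ∀ Γ f → Γ ∈ Lπ → f ∈ Γ → depth f ≤ suc k)
           (size< : ∀ Γ → Γ ∈ Lπ → suc (cedentSize Γ) ≤ M) where

    Allowed : Cedent → Set
    Allowed Γ = All (λ f → depth f ≤ k) Γ × cedentSize Γ ≤ M

    open Building (F ++ extAxioms extensions) Allowed public

    Allowed-lowerL : ∀ {Γ} → Γ ∈ Lπ → Allowed (lowerL Γ)
    Allowed-lowerL {Γ} Γ∈ =
      All-depth-lowerL k Γ (All.tabulate (λ {f} f∈ → depth≤ Γ f Γ∈ f∈)) ,
      ≤-trans (s≤s (sizeL-lowerL Γ)) (≤-trans (n≤1+n _) (size< Γ Γ∈))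

    room : ∀ {c Γ} (ls : List Literal) → (c ∷ Γ) ∈ Lπ → size c ≡ suc (length ls) → 2 + length ls + cedentSize (lowerL Γ) ≤ M
    room {c} {Γ} ls Γ∈ size-c = begin
      2 + length ls + cedentSize (lowerL Γ)  ≤⟨ +-monoʳ-≤ (2 + length ls) (s≤s (sizeL-lowerL Γ)) ⟩
      2 + length ls + suc (sizeL Γ)          ≡⟨ cong (λ m → suc (suc m)) (+-suc (length ls) (sizeL Γ)) ⟩
      2 + (suc (length ls) + sizeL Γ)        ≡⟨ cong (λ m → 2 + (m + sizeL Γ)) (sym size-c) ⟩
      suc (cedentSize (c ∷ Γ))               ≤⟨ size< _ Γ∈ ⟩
      M                                      ∎
      where open ≤-Reasoning

    module TermContext (Γt : Cedent) (Γt-depth : All (λ f → depth f ≤ k) Γt) (n : ℕ)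
                       (room′ : 2 + n + cedentSize Γt ≤ M) where

      Allowed-lits-++ : ∀ ls → length ls ≤ 2 + n → Allowed (map lit ls ++ Γt)
      Allowed-lits-++ ls len =
        ++⁺ (All-lit-depth≤ ls) Γt-depth ,
        ≤-trans (≤-reflexive (cedentSize-map-lit-++ ls Γt)) (≤-trans (+-monoˡ-≤ _ len) room′)

      Allowed-lits : ∀ ls → length ls ≤ 2 + n → Allowed (map lit ls)
      Allowed-lits ls len = All-lit-depth≤ ls , (begin
        cedentSize (map lit ls)   ≡⟨ cong suc (sizeL-map-lit ls) ⟩
        suc (length ls)           ≤⟨ s≤s len ⟩
        suc (2 + n)               ≡⟨ +-comm 1 (2 + n) ⟩
        2 + n + 1                 ≤⟨ +-monoʳ-≤ (2 + n) (s≤s z≤n) ⟩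
        2 + n + cedentSize Γt     ≤⟨ room′ ⟩
        M                         ∎)
        where open ≤-Reasoning

      1+n≤M : suc n ≤ M
      1+n≤M = ≤-trans (n≤1+n (suc n)) (≤-trans (m≤m+n (2 + n) (cedentSize Γt)) room′)

      Pending∧ : ℕ → List Literal → Cedent
      Pending∧ e ks = map lit (map negLit ks ++ pos e ∷ []) ++ Γt

      cut-premises : ∀ {l} e ks → length ks ≤ n → Derivable l (Pending∧ e ks) →
                     All (λ κ → Derivable l (lit κ ∷ Γt)) ks →
                     Builds l (length ks * 3) (λ l′ → Derivable l′ (lit (pos e) ∷ Γt))
      cut-premises e [] _ d [] = return d
      cut-premises e (κ ∷ ks) len d (dκ ∷ ds) =
        cut-on (lit κ) (Pending∧ e ks) (Derivable-weaken (∷⁺ʳ (lit κ) (xs⊆ys++xs Γt _)) dκ) d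
               (Allowed-lits-++ (κ ∷ rest) len′) (Allowed-lits-++ (negLit κ ∷ rest) len′)
               (Allowed-lits-++ rest (≤-trans (n≤1+n _) len′)) >>= λ s d′ →
        cut-premises e ks (≤-trans (n≤1+n _) len) d′ (All.map (Derivable-mono s) ds)
        where
        rest = map negLit ks ++ pos e ∷ []
        len′ : suc (length rest) ≤ 2 + n
        len′ = ≤-trans (≤-reflexive (cong suc (length-map-negLit-snoc ks (pos e)))) (≤-trans (s≤s len) (n≤1+n _))

      Pending∨ : ℕ → List Literal → Cedent
      Pending∨ e p = map lit (map negLit p ++ neg e ∷ []) ++ Γt

      cut-rejections : ∀ {l} ks → ks ∈ keys → length ks ≤ n → ∀ q p → ks ≡ p ++ q →
                       Derivable l (Pending∨ (extVar ks) ks) →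
                       Builds l (length q * 4) (λ l′ → Derivable l′ (Pending∨ (extVar ks) p))
      cut-rejections ks _ _ [] p ks≡ d =
        return (subst (λ p′ → Derivable _ (Pending∨ (extVar ks) p′)) (trans ks≡ (++-identityʳ p)) d)
      cut-rejections ks ks∈ len (κ ∷ q) p ks≡ d = within (≤-reflexive (+-comm (length q * 4) 4))
        (cut-rejections ks ks∈ len q (p ++ κ ∷ []) (trans ks≡ (sym (++-assoc p (κ ∷ []) q))) d >>= λ s₁ d₁ →
         hyp-line (∈-++⁺ʳ F (extAxiom∈ ks∈ rejects)) (Allowed-lits rejection len-rejection) >>= λ s₂ dh →
         cut-on (lit κ) (Pending∨ e p) (Derivable-weaken sub₁ dh) (Derivable-weaken sub₂ (Derivable-mono s₂ d₁))
                (Allowed-lits-++ (κ ∷ rest) len′) (Allowed-lits-++ (negLit κ ∷ rest) len′)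
                (Allowed-lits-++ rest (≤-trans (n≤1+n _) len′)))
        where
        e = extVar ks
        rest = map negLit p ++ neg e ∷ []
        rejection = negBranch (p ++ negLit κ ∷ []) ++ neg e ∷ []
        rejects : (p ++ negLit κ ∷ [] , false) ∈ branches (termTree ks)
        rejects = subst (λ ks′ → (p ++ negLit κ ∷ [] , false) ∈ branches (termTree ks′)) (sym ks≡) (termTree-rejects p κ q)
        1+p≤n : suc (length p) ≤ n
        1+p≤n = begin
          suc (length p)             ≤⟨ s≤s (m≤m+n (length p) (length q)) ⟩
          suc (length p + length q)  ≡⟨ sym (+-suc (length p) (length q)) ⟩
          length p + length (κ ∷ q)  ≡⟨ sym (trans (cong length ks≡) (length-++ p)) ⟩
          length ks                  ≤⟨ len ⟩
          n                          ∎
          where open ≤-Reasoning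
        len′ : suc (length rest) ≤ 2 + n
        len′ = ≤-trans (≤-reflexive (cong suc (length-map-negLit-snoc p (neg e)))) (s≤s (≤-trans 1+p≤n (n≤1+n n)))
        len-rejection : length rejection ≤ 2 + n
        len-rejection = ≤-trans (≤-reflexive (trans (length-map-negLit-snoc (p ++ negLit κ ∷ []) (neg e))
                                                   (cong suc (trans (length-++ p) (+-comm (length p) 1)))))
                                (s≤s (≤-trans 1+p≤n (n≤1+n n)))
        sub₁ : clauseCedent rejection ⊆ lit κ ∷ Pending∨ e p
        sub₁ = map-lit-⊆-++ʳ Γt (subst (λ ls → ls ++ neg e ∷ [] ⊆ κ ∷ rest)
                 (sym (trans (map-++-snoc negLit p (negLit κ)) (cong (λ κ′ → map negLit p ++ κ′ ∷ []) (negLit-involutive κ))))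
                 (snoc-snoc⊆ (map negLit p) κ (neg e)))
        sub₂ : Pending∨ e (p ++ κ ∷ []) ⊆ lit (negLit κ) ∷ Pending∨ e p
        sub₂ = map-lit-⊆-++ Γt (subst (λ ls → ls ++ neg e ∷ [] ⊆ negLit κ ∷ rest)
                 (sym (map-++-snoc negLit p κ)) (snoc-snoc⊆ (map negLit p) (negLit κ) (neg e)))

    perInference : ℕ
    perInference = M * M

    M≤perInference : M ≤ perInference
    M≤perInference = ≤-trans (≤-reflexive (sym (*-identityˡ M))) (*-monoˡ-≤ M (≤-trans (s≤s z≤n) 4≤M))

    ≤perInference : ∀ {j} → j ≤ 4 → j ≤ perInference
    ≤perInference j≤4 = ≤-trans j≤4 (≤-trans 4≤M M≤perInference)

    simulate-⋀-literals : ∀ {prev Γ fs ls l} → (⋀ fs ∷ Γ) ∈ Lπ → literals? fs ≡ just ls →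
                          All (λ f → (f ∷ Γ) ∈ prev) fs → Simulated lowerL prev l →
                          Builds l perInference (λ l′ → Derivable l′ (lit (pos (extVar (map σL ls))) ∷ lowerL Γ))
    simulate-⋀-literals {prev} {Γ} {fs} {ls} {l} Γ∈ eq prems sim = within cost
      (hyp-line (∈-++⁺ʳ F (extAxiom∈ ks∈ (termTree-accepts ks))) (Allowed-lits acceptance len-acceptance) >>= λ s dh →
       cut-premises (extVar ks) ks ≤-refl (Derivable-weaken (xs⊆xs++ys _ _) dh) (All.map (Derivable-mono s) premises))
      where
      fs≡ = literals?≡just fs eq
      ks = map σL ls
      ks∈ = ⋀-key∈keys Γ∈ (here refl) eq
      room-ks : 2 + length ks + cedentSize (lowerL Γ) ≤ M
      room-ks = subst (λ n → 2 + n + cedentSize (lowerL Γ) ≤ M) (sym (length-map σL ls))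
                      (room ls Γ∈ (cong suc (trans (cong sizeL fs≡) (sizeL-map-lit ls))))
      open TermContext (lowerL Γ) (All.tail (proj₁ (Allowed-lowerL Γ∈))) (length ks) room-ks
      acceptance = negBranch ks ++ pos (extVar ks) ∷ []
      len-acceptance : length acceptance ≤ 2 + length ks
      len-acceptance = ≤-trans (≤-reflexive (length-map-negLit-snoc ks _)) (n≤1+n _)
      premises : All (λ κ → Derivable l (lit κ ∷ lowerL Γ)) ks
      premises = All-map⁺ (All-map⁻ (All.map sim (subst (All (λ f → (f ∷ Γ) ∈ prev)) fs≡ prems)))
      cost : 1 + length ks * 3 ≤ perInference
      cost = ≤-trans (+-monoˡ-≤ (length ks * 3) (≤ᵇ⇒≤ 1 3 _)) (*-mono-≤ 1+n≤M (≤-trans (≤ᵇ⇒≤ 3 4 _) 4≤M))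

    simulate-⋁-literals : ∀ {prev Γ fs ls l} → (⋁ fs ∷ Γ) ∈ Lπ → literals? fs ≡ just ls →
                          (fs ++ Γ) ∈ prev → Simulated lowerL prev l →
                          Builds l perInference (λ l′ → Derivable l′ (lit (neg (extVar (map σL¬ ls))) ∷ lowerL Γ))
    simulate-⋁-literals {prev} {Γ} {fs} {ls} {l} Γ∈ eq prem sim =
      within cost (cut-rejections ks ks∈ ≤-refl ks [] refl start)
      where
      fs≡ = literals?≡just fs eq
      ks = map σL¬ ls
      ks∈ = ⋁-key∈keys Γ∈ (here refl) eq
      room-ks : 2 + length ks + cedentSize (lowerL Γ) ≤ M
      room-ks = subst (λ n → 2 + n + cedentSize (lowerL Γ) ≤ M) (sym (length-map σL¬ ls))
                      (room ls Γ∈ (cong suc (trans (cong sizeL fs≡) (sizeL-map-lit ls))))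
      open TermContext (lowerL Γ) (All.tail (proj₁ (Allowed-lowerL Γ∈))) (length ks) room-ks
      lowered-premise : lowerL (fs ++ Γ) ≡ map lit (map σL ls) ++ lowerL Γ
      lowered-premise = trans (lowerL-++ fs Γ) (cong (_++ lowerL Γ) (trans (cong lowerL fs≡) (lowerL-map-lit ls)))
      start : Derivable l (Pending∨ (extVar ks) ks)
      start = Derivable-weaken
        (subst (λ ls′ → lowerL (fs ++ Γ) ⊆ map lit (ls′ ++ neg (extVar ks) ∷ []) ++ lowerL Γ) (sym (map-negLit-σL¬ ls))
          (subst (_⊆ map lit (map σL ls ++ neg (extVar ks) ∷ []) ++ lowerL Γ) (sym lowered-premise)
            (map-lit-⊆-++ (lowerL Γ) (xs⊆xs++ys _ _))))
        (sim prem)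
      cost : length ks * 4 ≤ perInference
      cost = *-mono-≤ (≤-trans (n≤1+n _) 1+n≤M) 4≤M

    simulate-inference : ∀ {prev Γ l} → Inference F prev Γ → prev ⊆ Lπ → Γ ∈ Lπ → Simulated lowerL prev l →
                         Builds l perInference (λ l′ → Derivable l′ (lowerL Γ))
    simulate-inference (axiom p) _ Γ∈ _ = within (≤perInference (≤ᵇ⇒≤ 1 4 _)) (axiom-line (σ p) (Allowed-lowerL Γ∈))
    simulate-inference {l = l} (hyp {C} C∈) _ Γ∈ _ =
      within (≤perInference (≤ᵇ⇒≤ 1 4 _))
        (subst (λ Δ → Builds l 1 (λ l′ → Derivable l′ Δ)) (sym (lowerL-clause C∈))
          (hyp-line (∈-++⁺ˡ C∈) (subst Allowed (lowerL-clause C∈) (Allowed-lowerL Γ∈))))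
    simulate-inference (weak Γ′∈ Γ′⊆) _ _ sim = within z≤n (return (Derivable-weaken (lowerL-⊆ Γ′⊆) (sim Γ′∈)))
    simulate-inference (cut Γ A A∷Γ∈ dualA∷Γ∈) prev⊆ Γ∈ sim =
      within (≤perInference (≤ᵇ⇒≤ 3 4 _))
        (cut-on (lower A) (lowerL Γ) (sim A∷Γ∈) (Derivable-resp (lower-dual A) (sim dualA∷Γ∈))
          (Allowed-lowerL (prev⊆ A∷Γ∈)) (subst (λ f → Allowed (f ∷ lowerL Γ)) (lower-dual A) (Allowed-lowerL (prev⊆ dualA∷Γ∈)))
          (Allowed-lowerL Γ∈))
    simulate-inference (∨-intro Γ fs prem) prev⊆ Γ∈ sim with literals? fs in eq
    ... | just ls = simulate-⋁-literals Γ∈ eq prem sim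
    ... | nothing = within (≤perInference (≤ᵇ⇒≤ 2 4 _))
      (∨-intro-on (lowerL Γ) (lowerL fs) (subst (Derivable _) (lowerL-++ fs Γ) (sim prem))
        (subst Allowed (lowerL-++ fs Γ) (Allowed-lowerL (prev⊆ prem)))
        (subst (λ m → Allowed (lower⋁ fs m ∷ lowerL Γ)) eq (Allowed-lowerL Γ∈)))
    simulate-inference (∧-intro Γ fs prems) prev⊆ Γ∈ sim with literals? fs in eq
    ... | just ls = simulate-⋀-literals Γ∈ eq prems sim
    ... | nothing = within cost
      (∧-intro-on (lowerL Γ) (lowerL fs) (All-lowerL⁺ (All.map sim prems))
        (All-lowerL⁺ (All.map (Allowed-lowerL ∘ prev⊆) prems))
        (subst (λ m → Allowed (lower⋀ fs m ∷ lowerL Γ)) eq (Allowed-lowerL Γ∈)))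
      where
      cost : length (lowerL fs) * 1 + 1 ≤ perInference
      cost = begin
        length (lowerL fs) * 1 + 1    ≡⟨ cong (_+ 1) (trans (*-identityʳ _) (length-lowerL fs)) ⟩
        length fs + 1                 ≡⟨ +-comm (length fs) 1 ⟩
        suc (length fs)               ≤⟨ s≤s (≤-trans (length≤sizeL fs) (m≤m+n (sizeL fs) (sizeL Γ))) ⟩
        suc (sizeL fs + sizeL Γ)      ≤⟨ ≤-trans (n≤1+n _) (n≤1+n _) ⟩
        suc (cedentSize (⋀ fs ∷ Γ))   ≤⟨ size< _ Γ∈ ⟩
        M                             ≤⟨ M≤perInference ⟩
        perInference                  ∎
        where open ≤-Reasoning

one-line-refutation : ∀ {Ax} → [] ∈ Ax → Refutation Ax
one-line-refutation []∈ = refutation [] ([] ▷ hyp []∈)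

one-line-refutation-LK : ∀ {Ax} k ([]∈ : [] ∈ Ax) → IsLK k (one-line-refutation []∈)
one-line-refutation-LK k []∈ Γ f (here refl) ()
one-line-refutation-LK k []∈ Γ f (there ()) _

one-line-refutation-LKHalf : ∀ {Ax} k ([]∈ : [] ∈ Ax) → IsLKHalf k (one-line-refutation []∈)
one-line-refutation-LKHalf k []∈ =
  one-line-refutation-LK (suc k) []∈ , λ { Γ f g (here refl) () ; Γ f g (there ()) _ _ _ }

1≤qpoly : ∀ c s → 1 ≤ qpoly c s
1≤qpoly c s = m^n>0 2 (suc ⌊log₂ s ⌋ ^ c)

[]∈⇒LKDTRef : ∀ k {F} c s → [] ∈ F → LKDTRef k F (qpoly c s)
[]∈⇒LKDTRef k c s []∈F = [] , one-line-refutation []∈ , ([] , []) , one-line-refutation-LK k []∈ , 1≤qpoly c s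
  where []∈ = ∈-++⁺ˡ {ys = extAxioms []} []∈F

[]∈⇒LKHalfRef : ∀ k {F} c s → [] ∈ F → LKHalfRef k F (qpoly c s)
[]∈⇒LKHalfRef k c s []∈F = one-line-refutation []∈F , one-line-refutation-LKHalf k []∈F , 1≤qpoly c s

module LoweredRefutation {k F s} (π : Refutation F) (half : IsLKHalf k π) (π≤s : refSize π ≤ s)
                         ([]∉F : ¬ ([] ∈ F)) {x₀} (x₀∈ : x₀ ∈ vars F) where

  open Lowering F x₀ x₀∈ (lines π) public

  2≤s : 2 ≤ s
  2≤s = ≤-trans (2≤refSize π []∉F) π≤s

  P : ℕ
  P = 2 ^ suc ⌊log₂ s ⌋

  s<P : s < P
  s<P = <2^suc⌊log₂⌋ s

  4≤P : 4 ≤ P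
  4≤P = ^-monoʳ-≤ 2 {2} (s≤s (1≤⌊log₂⌋ 2≤s))

  size<P : ∀ Γ → Γ ∈ lines π → suc (cedentSize Γ) ≤ P
  size<P Γ Γ∈ = ≤-trans (s≤s (≤-trans (cedentSize≤proofSize (lines π) Γ∈) π≤s)) s<P

  open LoweringSimulation k P 4≤P (proj₁ half) size<P
  open PowerBounds P (≤-trans (s≤s (s≤s z≤n)) 4≤P)

  built : Extended [] (length (lines π) * perInference) (λ l → Derivable l [])
  built = map-result (λ sim → sim (here refl)) (simulate lowerL simulate-inference (deriv π) ⊆-refl) [] []

  π′ : Refutation (F ++ extAxioms extensions)
  π′ = refutation-from built (refSize π)

  π≤π′ : refSize π ≤ refSize π′
  π≤π′ = ≤-trans (≤-trans (m≤m+n _ _) (n≤1+n _)) (≤-reflexive (sym (refSize-refutation-from built (refSize π))))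

  π′-LK : IsLK k π′
  π′-LK Γ f Γ∈ f∈ = formula-of-refutation-from built (refSize π) (λ allowed f∈ → All.lookup (proj₁ allowed) f∈) Γ∈ f∈

  π′-size : refSize π′ ≤ qpoly 9 s
  π′-size = ≤qpoly9 s (refSize π′) 5 2≤s (≤ᵇ⇒≤ 5 256 _) (begin
    refSize π′                              ≡⟨ refSize-refutation-from built (refSize π) ⟩
    suc (refSize π + proofSize lines′)      ≤⟨ +-≤P^ {a = 4} (≤P^-mono {a = 1} (≤P^1 (≤-trans (s≤s π≤s) s<P)) (≤ᵇ⇒≤ 1 4 _)) lines′-size ⟩
    P ^ 5                                   ∎)
    where
    open ≤-Reasoning
    open Extended built
    s≤P : s ≤ P
    s≤P = <⇒≤ s<P
    lines′-size : proofSize lines′ ≤ P ^ 4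
    lines′-size = begin
      proofSize lines′                  ≤⟨ proofSize≤length* lines′ (All.map proj₂ allowed) ⟩
      length lines′ * P                 ≤⟨ *-monoˡ-≤ P (≤-trans length≤ (≤-reflexive (+-identityʳ _))) ⟩
      length (lines π) * (P * P) * P    ≤⟨ *-≤P^ {a = 3} {b = 1}
                                             (*-≤P^ {a = 1} {b = 2} (≤P^1 (≤-trans (≤-trans (length≤proofSize (lines π)) π≤s) s≤P))
                                                                    (*-≤P^ {a = 1} {b = 1} (≤P^1 ≤-refl) (≤P^1 ≤-refl)))
                                             (≤P^1 ≤-refl) ⟩
      P ^ 4                             ∎

  key-facts : ∀ {ks} → ks ∈ keys → All (λ κ → var κ ∈ vars F) ks × length ks ≤ ⌊log₂ refSize π′ ⌋
  key-facts {ks} ks∈ with key-origin ks∈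
  ... | Γ , f , Γ∈ , f∈ , ks∈f with keysOf-facts f ks∈f
  ...   | vars∈ , depth≡1 , len<size = vars∈ , (begin
    length ks             ≤⟨ n≤1+n _ ⟩
    suc (length ks)       ≤⟨ len<size ⟩
    size f                ≤⟨ proj₂ half Γ f f Γ∈ f∈ here depth≡1 ⟩
    ⌊log₂ refSize π ⌋     ≤⟨ ⌊log₂⌋-mono-≤ π≤π′ ⟩
    ⌊log₂ refSize π′ ⌋    ∎)
    where open ≤-Reasoning

  extensions-valid : ValidExt F ⌊log₂ refSize π′ ⌋ extensions
  extensions-valid =
    termExtensions-All _ keys fresh (λ ks e ks∈ fresh≤e →
      queries-termTree ks (proj₁ (key-facts ks∈)) ,
      ≤-trans (≤-reflexive (dtDepth-termTree ks)) (proj₂ (key-facts ks∈)) ,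
      fresh≤⇒∉vars fresh≤e) ,
    termExtensions-AllPairs _ (λ e≢e′ → e≢e′) keys fresh

LKHalf⇒LKDT : ∀ k F s → LKHalfRef k F s → LKDTRef k F (qpoly 9 s)
LKHalf⇒LKDT k F s (π , half , π≤s) with []∈? F
... | yes []∈F = []∈⇒LKDTRef k 9 s []∈F
... | no []∉F with vars F in vars≡
...   | [] = ⊥-elim (no-refutation-of-[] (subst Refutation (vars≡[]⇒≡[] F vars≡ []∉F) π))
...   | x₀ ∷ _ = extensions , π′ , extensions-valid , π′-LK , π′-size
  where open LoweredRefutation π half π≤s []∉F (subst (x₀ ∈_) (sym vars≡) (here refl))

-- Paths of decision trees

paths : (Bool → List (List Literal)) → DTree → List (List Literal)
paths atLeaf (leaf o) = atLeaf o
paths atLeaf (node x t₀ t₁) = map (neg x ∷_) (paths atLeaf t₀) ++ map (pos x ∷_) (paths atLeaf t₁)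

acceptLeaf : Bool → List (List Literal)
acceptLeaf true = [] ∷ []
acceptLeaf false = []

accepting rejecting allPaths : DTree → List (List Literal)
accepting = paths acceptLeaf
rejecting = paths (acceptLeaf ∘ not)
allPaths = paths (λ _ → [] ∷ [])

varTree : ℕ → DTree
varTree x = node x (leaf false) (leaf true)

negateTree : DTree → DTree
negateTree (leaf o) = leaf (not o)
negateTree (node x t₀ t₁) = node x (negateTree t₀) (negateTree t₁)

dtDepth-negateTree : ∀ T → dtDepth (negateTree T) ≡ dtDepth T
dtDepth-negateTree (leaf o) = refl
dtDepth-negateTree (node x t₀ t₁) = cong suc (cong₂ _⊔_ (dtDepth-negateTree t₀) (dtDepth-negateTree t₁))

paths-negateTree : ∀ f T → paths f (negateTree T) ≡ paths (f ∘ not) T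
paths-negateTree f (leaf o) = refl
paths-negateTree f (node x t₀ t₁) =
  cong₂ (λ p₀ p₁ → map (neg x ∷_) p₀ ++ map (pos x ∷_) p₁) (paths-negateTree f t₀) (paths-negateTree f t₁)

paths-cong : ∀ {f g} → (∀ o → f o ≡ g o) → ∀ T → paths f T ≡ paths g T
paths-cong f≗g (leaf o) = f≗g o
paths-cong f≗g (node x t₀ t₁) =
  cong₂ (λ p₀ p₁ → map (neg x ∷_) p₀ ++ map (pos x ∷_) p₁) (paths-cong f≗g t₀) (paths-cong f≗g t₁)

accepting-negateTree : ∀ T → accepting (negateTree T) ≡ rejecting T
accepting-negateTree = paths-negateTree acceptLeaf

rejecting-negateTree : ∀ T → rejecting (negateTree T) ≡ accepting T
rejecting-negateTree T =
  trans (paths-negateTree (acceptLeaf ∘ not) T) (paths-cong (λ o → cong acceptLeaf (not-involutive o)) T)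

∈-paths-node⁻ : ∀ f x t₀ t₁ {b} → b ∈ paths f (node x t₀ t₁) →
                (∃[ b′ ] b′ ∈ paths f t₀ × b ≡ neg x ∷ b′) ⊎ (∃[ b′ ] b′ ∈ paths f t₁ × b ≡ pos x ∷ b′)
∈-paths-node⁻ f x t₀ t₁ b∈ with ∈-++⁻ (map (neg x ∷_) (paths f t₀)) b∈
... | inj₁ b∈₀ = inj₁ (∈-map⁻ (neg x ∷_) b∈₀)
... | inj₂ b∈₁ = inj₂ (∈-map⁻ (pos x ∷_) b∈₁)

∈-paths-node⁺ˡ : ∀ f x t₀ t₁ {b} → b ∈ paths f t₀ → (neg x ∷ b) ∈ paths f (node x t₀ t₁)
∈-paths-node⁺ˡ f x t₀ t₁ b∈ = ∈-++⁺ˡ (∈-map⁺ (neg x ∷_) b∈)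

∈-paths-node⁺ʳ : ∀ f x t₀ t₁ {b} → b ∈ paths f t₁ → (pos x ∷ b) ∈ paths f (node x t₀ t₁)
∈-paths-node⁺ʳ f x t₀ t₁ b∈ = ∈-++⁺ʳ (map (neg x ∷_) (paths f t₀)) (∈-map⁺ (pos x ∷_) b∈)

length-paths : ∀ {f} → (∀ o → length (f o) ≤ 1) → ∀ T → length (paths f T) ≤ 2 ^ dtDepth T
length-paths leaf≤1 (leaf o) = leaf≤1 o
length-paths {f} leaf≤1 (node x t₀ t₁) = begin
  length (map (neg x ∷_) (paths f t₀) ++ map (pos x ∷_) (paths f t₁))
    ≡⟨ trans (length-++ (map (neg x ∷_) (paths f t₀))) (cong₂ _+_ (length-map _ (paths f t₀)) (length-map _ (paths f t₁))) ⟩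
  length (paths f t₀) + length (paths f t₁)
    ≤⟨ +-mono-≤ (≤-trans (length-paths leaf≤1 t₀) (^-monoʳ-≤ 2 (m≤m⊔n (dtDepth t₀) (dtDepth t₁))))
                (≤-trans (length-paths leaf≤1 t₁) (^-monoʳ-≤ 2 (m≤n⊔m (dtDepth t₀) (dtDepth t₁)))) ⟩
  2 ^ d + 2 ^ d
    ≡⟨ cong (2 ^ d +_) (sym (+-identityʳ _)) ⟩
  2 ^ suc d ∎
  where
  open ≤-Reasoning
  d = dtDepth t₀ ⊔ dtDepth t₁

length-accepting : ∀ T → length (accepting T) ≤ 2 ^ dtDepth T
length-accepting = length-paths λ { true → s≤s z≤n ; false → z≤n }

length-rejecting : ∀ T → length (rejecting T) ≤ 2 ^ dtDepth T
length-rejecting = length-paths λ { true → z≤n ; false → s≤s z≤n }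

length-allPaths : ∀ T → length (allPaths T) ≤ 2 ^ dtDepth T
length-allPaths = length-paths λ _ → s≤s z≤n

paths⊆allPaths : ∀ {f} → (∀ o → f o ⊆ [] ∷ []) → ∀ T → paths f T ⊆ allPaths T
paths⊆allPaths leaf⊆ (leaf o) = leaf⊆ o
paths⊆allPaths {f} leaf⊆ (node x t₀ t₁) b∈ with ∈-paths-node⁻ f x t₀ t₁ b∈
... | inj₁ (b′ , b′∈ , refl) = ∈-paths-node⁺ˡ _ x t₀ t₁ (paths⊆allPaths leaf⊆ t₀ b′∈)
... | inj₂ (b′ , b′∈ , refl) = ∈-paths-node⁺ʳ _ x t₀ t₁ (paths⊆allPaths leaf⊆ t₁ b′∈)

accepting⊆allPaths : ∀ T → accepting T ⊆ allPaths T
accepting⊆allPaths = paths⊆allPaths λ { true b∈ → b∈ ; false () }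

rejecting⊆allPaths : ∀ T → rejecting T ⊆ allPaths T
rejecting⊆allPaths = paths⊆allPaths λ { true () ; false b∈ → b∈ }

allPaths⊆accepting++rejecting : ∀ T → allPaths T ⊆ accepting T ++ rejecting T
allPaths⊆accepting++rejecting (leaf true) b∈ = ∈-++⁺ˡ b∈
allPaths⊆accepting++rejecting (leaf false) b∈ = b∈
allPaths⊆accepting++rejecting (node x t₀ t₁) b∈ with ∈-paths-node⁻ _ x t₀ t₁ b∈
... | inj₁ (b′ , b′∈ , refl) with ∈-++⁻ (accepting t₀) (allPaths⊆accepting++rejecting t₀ b′∈)
...   | inj₁ acc = ∈-++⁺ˡ (∈-paths-node⁺ˡ _ x t₀ t₁ acc)
...   | inj₂ rej = ∈-++⁺ʳ (accepting (node x t₀ t₁)) (∈-paths-node⁺ˡ _ x t₀ t₁ rej)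
allPaths⊆accepting++rejecting (node x t₀ t₁) b∈ | inj₂ (b′ , b′∈ , refl)
  with ∈-++⁻ (accepting t₁) (allPaths⊆accepting++rejecting t₁ b′∈)
...   | inj₁ acc = ∈-++⁺ˡ (∈-paths-node⁺ʳ _ x t₀ t₁ acc)
...   | inj₂ rej = ∈-++⁺ʳ (accepting (node x t₀ t₁)) (∈-paths-node⁺ʳ _ x t₀ t₁ rej)

length-∈allPaths : ∀ T {b} → b ∈ allPaths T → length b ≤ dtDepth T
length-∈allPaths (leaf o) (here refl) = z≤n
length-∈allPaths (node x t₀ t₁) b∈ with ∈-paths-node⁻ _ x t₀ t₁ b∈
... | inj₁ (b′ , b′∈ , refl) = s≤s (≤-trans (length-∈allPaths t₀ b′∈) (m≤m⊔n _ _))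
... | inj₂ (b′ , b′∈ , refl) = s≤s (≤-trans (length-∈allPaths t₁ b′∈) (m≤n⊔m _ _))

branch⇒∈paths : ∀ {f} T {b o} → (b , o) ∈ branches T → [] ∈ f o → b ∈ paths f T
branch⇒∈paths (leaf o) (here refl) []∈ = []∈
branch⇒∈paths {f} (node x t₀ t₁) br∈ []∈ with ∈-++⁻ (map (consLit (neg x)) (branches t₀)) br∈
... | inj₁ br∈₀ with ∈-map⁻ (consLit (neg x)) br∈₀
...   | (b′ , o′) , br′∈ , refl = ∈-paths-node⁺ˡ f x t₀ t₁ (branch⇒∈paths t₀ br′∈ []∈)
branch⇒∈paths {f} (node x t₀ t₁) br∈ []∈ | inj₂ br∈₁ with ∈-map⁻ (consLit (pos x)) br∈₁
...   | (b′ , o′) , br′∈ , refl = ∈-paths-node⁺ʳ f x t₀ t₁ (branch⇒∈paths t₁ br′∈ []∈)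

var∈queries : ∀ T {b y} → b ∈ allPaths T → y ∈ b → var y ∈ queries T
var∈queries (leaf o) (here refl) ()
var∈queries (node x t₀ t₁) b∈ y∈ with ∈-paths-node⁻ _ x t₀ t₁ b∈
var∈queries (node x t₀ t₁) b∈ (here refl) | inj₁ (_ , _ , refl) = here refl
var∈queries (node x t₀ t₁) b∈ (there y∈) | inj₁ (_ , b′∈ , refl) = there (∈-++⁺ˡ (var∈queries t₀ b′∈ y∈))
var∈queries (node x t₀ t₁) b∈ (here refl) | inj₂ (_ , _ , refl) = here refl
var∈queries (node x t₀ t₁) b∈ (there y∈) | inj₂ (_ , b′∈ , refl) = there (∈-++⁺ʳ (queries t₀) (var∈queries t₁ b′∈ y∈))

accepting-rejecting-clash : ∀ T {a b} → a ∈ accepting T → b ∈ rejecting T → ∃[ y ] y ∈ a × negLit y ∈ b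
accepting-rejecting-clash (leaf true) _ ()
accepting-rejecting-clash (leaf false) () _
accepting-rejecting-clash (node x t₀ t₁) a∈ b∈ with ∈-paths-node⁻ _ x t₀ t₁ a∈ | ∈-paths-node⁻ _ x t₀ t₁ b∈
... | inj₁ (_ , a′∈ , refl) | inj₁ (_ , b′∈ , refl) with accepting-rejecting-clash t₀ a′∈ b′∈
...   | y , y∈ , ¬y∈ = y , there y∈ , there ¬y∈
accepting-rejecting-clash (node x t₀ t₁) a∈ b∈ | inj₂ (_ , a′∈ , refl) | inj₂ (_ , b′∈ , refl)
  with accepting-rejecting-clash t₁ a′∈ b′∈
...   | y , y∈ , ¬y∈ = y , there y∈ , there ¬y∈
accepting-rejecting-clash (node x t₀ t₁) a∈ b∈ | inj₁ (_ , _ , refl) | inj₂ (_ , _ , refl) = neg x , here refl , here refl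
accepting-rejecting-clash (node x t₀ t₁) a∈ b∈ | inj₂ (_ , _ , refl) | inj₁ (_ , _ , refl) = pos x , here refl , here refl

-- From LK_k with shallow decision trees to LK_{k+½}

treeOf : List Extension → ℕ → DTree
treeOf [] x = varTree x
treeOf ((T , e) ∷ A) x with x ≟ e
... | yes _ = T
... | no _ = treeOf A x

treeOf-original : ∀ {F d} A → ValidExt F d A → ∀ {x} → x ∈ vars F → treeOf A x ≡ varTree x
treeOf-original [] _ _ = refl
treeOf-original {F} {d} ((T , e) ∷ A) (ok ∷ oks , _ ∷ distinct) {x} x∈ with x ≟ e
... | yes refl = ⊥-elim (proj₂ (proj₂ ok) x∈)
... | no _ = treeOf-original {F} {d} A (oks , distinct) x∈

treeOf-extension : ∀ {F d} A → ValidExt F d A → ∀ {T e} → (T , e) ∈ A → treeOf A e ≡ T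
treeOf-extension ((T , e) ∷ A) _ (here refl) with e ≟ e
... | yes _ = refl
... | no e≢e = ⊥-elim (e≢e refl)
treeOf-extension {F} {d} ((T′ , e′) ∷ A) (_ ∷ oks , fresh ∷ distinct) {T} {e} (there Te∈) with e ≟ e′
... | yes refl = ⊥-elim (All.lookup fresh Te∈ refl)
... | no _ = treeOf-extension {F} {d} A (oks , distinct) Te∈

dtDepth-treeOf : ∀ {F d} A → ValidExt F d A → ∀ x → dtDepth (treeOf A x) ≤ suc d
dtDepth-treeOf [] _ x = s≤s z≤n
dtDepth-treeOf {F} {d} ((T , e) ∷ A) (ok ∷ oks , _ ∷ distinct) x with x ≟ e
... | yes _ = ≤-trans (proj₁ (proj₂ ok)) (n≤1+n _)
... | no _ = dtDepth-treeOf {F} {d} A (oks , distinct) x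

term : List Literal → Formula
term b = ⋀ (map lit b)

¬term : List Literal → Formula
¬term b = ⋁ (map lit (map negLit b))

dual-term : ∀ b → dual (term b) ≡ ¬term b
dual-term b = cong ⋁ (dualL-map-lit b)

dual-¬term : ∀ b → dual (¬term b) ≡ term b
dual-¬term b = cong ⋀ (trans (dualL-map-lit (map negLit b)) (cong (map lit) (map-negLit-involutive b)))

dualL-map-¬term : ∀ bs → dualL (map ¬term bs) ≡ map term bs
dualL-map-¬term [] = refl
dualL-map-¬term (b ∷ bs) = cong₂ _∷_ (dual-¬term b) (dualL-map-¬term bs)

dualL-map-term : ∀ bs → dualL (map term bs) ≡ map ¬term bs
dualL-map-term [] = refl
dualL-map-term (b ∷ bs) = cong₂ _∷_ (dual-term b) (dualL-map-term bs)

depth-term : ∀ b → depth (term b) ≡ 1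
depth-term b = cong suc (depthL-map-lit b)

depth-¬term : ∀ b → depth (¬term b) ≡ 1
depth-¬term b = depth-term (map negLit b)

size-term : ∀ b → size (term b) ≡ suc (length b)
size-term b = cong suc (sizeL-map-lit b)

size-¬term : ∀ b → size (¬term b) ≡ suc (length b)
size-¬term b = cong suc (trans (sizeL-map-lit (map negLit b)) (length-map negLit b))

Bottom≤ : ℕ → Formula → Set
Bottom≤ B f = ∀ g → g ≼ f → depth g ≡ 1 → size g ≤ B

Bottom≤-lit : ∀ {B} l → Bottom≤ B (lit l)
Bottom≤-lit l .(lit l) here ()

Bottom≤-⋀ : ∀ {B} gs → All (Bottom≤ B) gs → (depth (⋀ gs) ≡ 1 → size (⋀ gs) ≤ B) → Bottom≤ B (⋀ gs)
Bottom≤-⋀ gs _ top .(⋀ gs) here d≡1 = top d≡1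
Bottom≤-⋀ gs below _ g (inAnd g′∈ g≼) d≡1 = All.lookup below g′∈ g g≼ d≡1

Bottom≤-⋁ : ∀ {B} gs → All (Bottom≤ B) gs → (depth (⋁ gs) ≡ 1 → size (⋁ gs) ≤ B) → Bottom≤ B (⋁ gs)
Bottom≤-⋁ gs _ top .(⋁ gs) here d≡1 = top d≡1
Bottom≤-⋁ gs below _ g (inOr g′∈ g≼) d≡1 = All.lookup below g′∈ g g≼ d≡1

All-Bottom≤-lit : ∀ {B} ls → All (Bottom≤ B) (map lit ls)
All-Bottom≤-lit [] = []
All-Bottom≤-lit (l ∷ ls) = Bottom≤-lit l ∷ All-Bottom≤-lit ls

Bottom≤-term : ∀ {B} b → suc (length b) ≤ B → Bottom≤ B (term b)
Bottom≤-term b len = Bottom≤-⋀ (map lit b) (All-Bottom≤-lit b) (λ _ → ≤-trans (≤-reflexive (size-term b)) len)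

Bottom≤-¬term : ∀ {B} b → suc (length b) ≤ B → Bottom≤ B (¬term b)
Bottom≤-¬term b len =
  Bottom≤-⋁ (map lit (map negLit b)) (All-Bottom≤-lit (map negLit b)) (λ _ → ≤-trans (≤-reflexive (size-¬term b)) len)

depthL≡0⇒≡[] : ∀ gs → All (λ g → 1 ≤ depth g) gs → depthL gs ≡ 0 → gs ≡ []
depthL≡0⇒≡[] [] _ _ = refl
depthL≡0⇒≡[] (g ∷ gs) (1≤ ∷ _) d≡0 = ⊥-elim (1+n≰n (≤-trans 1≤ (≤-trans (m≤m⊔n (depth g) (depthL gs)) (≤-reflexive d≡0))))

module Expansion (F : CNF) (A : List Extension) (d : ℕ) (valid : ValidExt F d A) where

  literalTree : Literal → DTree
  literalTree (pos x) = treeOf A x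
  literalTree (neg x) = negateTree (treeOf A x)

  accepting-literalTree-negLit : ∀ l → accepting (literalTree (negLit l)) ≡ rejecting (literalTree l)
  accepting-literalTree-negLit (pos x) = accepting-negateTree (treeOf A x)
  accepting-literalTree-negLit (neg x) = sym (rejecting-negateTree (treeOf A x))

  rejecting-literalTree-negLit : ∀ l → rejecting (literalTree (negLit l)) ≡ accepting (literalTree l)
  rejecting-literalTree-negLit (pos x) = rejecting-negateTree (treeOf A x)
  rejecting-literalTree-negLit (neg x) = sym (accepting-negateTree (treeOf A x))

  dtDepth-literalTree : ∀ l → dtDepth (literalTree l) ≤ suc d
  dtDepth-literalTree (pos x) = dtDepth-treeOf {F} {d} A valid x
  dtDepth-literalTree (neg x) = ≤-trans (≤-reflexive (dtDepth-negateTree (treeOf A x))) (dtDepth-treeOf {F} {d} A valid x)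

  accepting-literalTree-original : ∀ y → var y ∈ vars F → accepting (literalTree y) ≡ (y ∷ []) ∷ []
  accepting-literalTree-original (pos x) x∈ rewrite treeOf-original {F} {d} A valid x∈ = refl
  accepting-literalTree-original (neg x) x∈ rewrite treeOf-original {F} {d} A valid x∈ = refl

  disjuncts : Literal → List Formula
  disjuncts l = map term (accepting (literalTree l))

  conjuncts : Literal → List Formula
  conjuncts l = map ¬term (rejecting (literalTree l))

  -- A literal l becomes the disjunction of the terms of the accepting paths of its tree, or,
  -- inside a conjunction, the equivalent conjunction of the negated rejecting paths; these are
  -- merged into the surrounding ⋁ or ⋀, so the depth grows by at most one.
  mutual
    expand : Formula → Formula
    expand (lit l) = lit l
    expand (⋀ fs) = ⋀ (expand∧ fs)
    expand (⋁ fs) = ⋁ (expand∨ fs)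

    expand∨ : List Formula → List Formula
    expand∨ [] = []
    expand∨ (lit l ∷ fs) = disjuncts l ++ expand∨ fs
    expand∨ (⋀ gs ∷ fs) = expand (⋀ gs) ∷ expand∨ fs
    expand∨ (⋁ gs ∷ fs) = expand (⋁ gs) ∷ expand∨ fs

    expand∧ : List Formula → List Formula
    expand∧ [] = []
    expand∧ (lit l ∷ fs) = conjuncts l ++ expand∧ fs
    expand∧ (⋀ gs ∷ fs) = expand (⋀ gs) ∷ expand∧ fs
    expand∧ (⋁ gs ∷ fs) = expand (⋁ gs) ∷ expand∧ fs

  expand∨₁ : Formula → List Formula
  expand∨₁ (lit l) = disjuncts l
  expand∨₁ f@(⋀ _) = expand f ∷ []
  expand∨₁ f@(⋁ _) = expand f ∷ []

  expand∧₁ : Formula → List Formula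
  expand∧₁ (lit l) = conjuncts l
  expand∧₁ f@(⋀ _) = expand f ∷ []
  expand∧₁ f@(⋁ _) = expand f ∷ []

  expand∨-∷ : ∀ f fs → expand∨ (f ∷ fs) ≡ expand∨₁ f ++ expand∨ fs
  expand∨-∷ (lit l) fs = refl
  expand∨-∷ (⋀ _) fs = refl
  expand∨-∷ (⋁ _) fs = refl

  expand∧-∷ : ∀ f fs → expand∧ (f ∷ fs) ≡ expand∧₁ f ++ expand∧ fs
  expand∧-∷ (lit l) fs = refl
  expand∧-∷ (⋀ _) fs = refl
  expand∧-∷ (⋁ _) fs = refl

  expand∨-++ : ∀ fs gs → expand∨ (fs ++ gs) ≡ expand∨ fs ++ expand∨ gs
  expand∨-++ [] gs = refl
  expand∨-++ (f ∷ fs) gs = begin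
    expand∨ (f ∷ fs ++ gs)                    ≡⟨ expand∨-∷ f (fs ++ gs) ⟩
    expand∨₁ f ++ expand∨ (fs ++ gs)          ≡⟨ cong (expand∨₁ f ++_) (expand∨-++ fs gs) ⟩
    expand∨₁ f ++ expand∨ fs ++ expand∨ gs    ≡⟨ sym (++-assoc (expand∨₁ f) (expand∨ fs) (expand∨ gs)) ⟩
    (expand∨₁ f ++ expand∨ fs) ++ expand∨ gs  ≡⟨ cong (_++ expand∨ gs) (sym (expand∨-∷ f fs)) ⟩
    expand∨ (f ∷ fs) ++ expand∨ gs            ∎
    where open ≡-Reasoning

  expand∨₁⊆expand∨ : ∀ {f fs} → f ∈ fs → expand∨₁ f ⊆ expand∨ fs
  expand∨₁⊆expand∨ {f} {_ ∷ fs} (here refl) g∈ = subst (_ ∈_) (sym (expand∨-∷ f fs)) (∈-++⁺ˡ g∈)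
  expand∨₁⊆expand∨ {f} {f′ ∷ fs} (there f∈) g∈ =
    subst (_ ∈_) (sym (expand∨-∷ f′ fs)) (∈-++⁺ʳ (expand∨₁ f′) (expand∨₁⊆expand∨ f∈ g∈))

  ∈-expand∨⁻ : ∀ {g} fs → g ∈ expand∨ fs → ∃[ f ] f ∈ fs × g ∈ expand∨₁ f
  ∈-expand∨⁻ (f ∷ fs) g∈ with ∈-++⁻ (expand∨₁ f) (subst (_ ∈_) (expand∨-∷ f fs) g∈)
  ... | inj₁ g∈f = f , here refl , g∈f
  ... | inj₂ g∈fs with ∈-expand∨⁻ fs g∈fs
  ...   | f′ , f′∈ , g∈f′ = f′ , there f′∈ , g∈f′

  expand∨-⊆ : ∀ {fs gs} → fs ⊆ gs → expand∨ fs ⊆ expand∨ gs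
  expand∨-⊆ {fs} fs⊆ g∈ with ∈-expand∨⁻ fs g∈
  ... | f , f∈ , g∈f = expand∨₁⊆expand∨ (fs⊆ f∈) g∈f

  mutual
    expand∨-dualL : ∀ fs → expand∨ (dualL fs) ≡ dualL (expand∧ fs)
    expand∨-dualL [] = refl
    expand∨-dualL (lit l ∷ fs) =
      trans (cong₂ _++_ (trans (cong (map term) (accepting-literalTree-negLit l)) (sym (dualL-map-¬term (rejecting (literalTree l)))))
                        (expand∨-dualL fs))
            (sym (dualL-++ (conjuncts l) (expand∧ fs)))
    expand∨-dualL (⋀ gs ∷ fs) = cong₂ _∷_ (cong ⋁ (expand∨-dualL gs)) (expand∨-dualL fs)
    expand∨-dualL (⋁ gs ∷ fs) = cong₂ _∷_ (cong ⋀ (expand∧-dualL gs)) (expand∨-dualL fs)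

    expand∧-dualL : ∀ fs → expand∧ (dualL fs) ≡ dualL (expand∨ fs)
    expand∧-dualL [] = refl
    expand∧-dualL (lit l ∷ fs) =
      trans (cong₂ _++_ (trans (cong (map ¬term) (rejecting-literalTree-negLit l)) (sym (dualL-map-term (accepting (literalTree l)))))
                        (expand∧-dualL fs))
            (sym (dualL-++ (disjuncts l) (expand∨ fs)))
    expand∧-dualL (⋀ gs ∷ fs) = cong₂ _∷_ (cong ⋁ (expand∨-dualL gs)) (expand∧-dualL fs)
    expand∧-dualL (⋁ gs ∷ fs) = cong₂ _∷_ (cong ⋀ (expand∧-dualL gs)) (expand∧-dualL fs)

  expand-dual : ∀ f → expand (dual f) ≡ dual (expand f)
  expand-dual (lit l) = refl
  expand-dual (⋀ fs) = cong ⋁ (expand∨-dualL fs)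
  expand-dual (⋁ fs) = cong ⋀ (expand∧-dualL fs)

  All-expand∨-∷ : ∀ {P : Formula → Set} f fs → All P (expand∨₁ f) → All P (expand∨ fs) → All P (expand∨ (f ∷ fs))
  All-expand∨-∷ f fs p ps = subst (All _) (sym (expand∨-∷ f fs)) (++⁺ p ps)

  All-expand∧-∷ : ∀ {P : Formula → Set} f fs → All P (expand∧₁ f) → All P (expand∧ fs) → All P (expand∧ (f ∷ fs))
  All-expand∧-∷ f fs p ps = subst (All _) (sym (expand∧-∷ f fs)) (++⁺ p ps)

  All-expand∧⁺ : ∀ {P : Formula → Set} fs → All (λ f → All P (expand∧₁ f)) fs → All P (expand∧ fs)
  All-expand∧⁺ [] [] = []
  All-expand∧⁺ (f ∷ fs) (p ∷ ps) = All-expand∧-∷ f fs p (All-expand∧⁺ fs ps)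

  All-map-term : ∀ {P : Formula → Set} bs → (∀ {b} → b ∈ bs → P (term b)) → All P (map term bs)
  All-map-term bs p = All-map⁺ (All.tabulate p)

  All-map-¬term : ∀ {P : Formula → Set} bs → (∀ {b} → b ∈ bs → P (¬term b)) → All P (map ¬term bs)
  All-map-¬term bs p = All-map⁺ (All.tabulate p)

  depth≡1⇒≤ : ∀ g {m} → depth g ≡ 1 → 1 ≤ m → depth g ≤ m
  depth≡1⇒≤ g d≡1 1≤m = ≤-trans (≤-reflexive d≡1) 1≤m

  mutual
    depth-expand : ∀ f → depth (expand f) ≤ suc (depth f)
    depth-expand (lit l) = z≤n
    depth-expand (⋀ fs) = s≤s (All⇒depthL≤ (expand∧ fs) (All-depth-expand∧ fs))
    depth-expand (⋁ fs) = s≤s (All⇒depthL≤ (expand∨ fs) (All-depth-expand∨ fs))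

    All-depth-expand∧ : ∀ fs → All (λ g → depth g ≤ suc (depthL fs)) (expand∧ fs)
    All-depth-expand∧ [] = []
    All-depth-expand∧ (f ∷ fs) = All-expand∧-∷ f fs (All.map (λ p → ≤-trans p (s≤s (m≤m⊔n _ _))) (head f))
                                                   (All.map (λ p → ≤-trans p (s≤s (m≤n⊔m _ _))) (All-depth-expand∧ fs))
      where
      head : ∀ f → All (λ g → depth g ≤ suc (depth f)) (expand∧₁ f)
      head (lit l) = All-map-¬term _ λ {b} _ → depth≡1⇒≤ (¬term b) (depth-¬term b) (s≤s z≤n)
      head (⋀ gs) = depth-expand (⋀ gs) ∷ []
      head (⋁ gs) = depth-expand (⋁ gs) ∷ []

    All-depth-expand∨ : ∀ fs → All (λ g → depth g ≤ suc (depthL fs)) (expand∨ fs)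
    All-depth-expand∨ [] = []
    All-depth-expand∨ (f ∷ fs) = All-expand∨-∷ f fs (All.map (λ p → ≤-trans p (s≤s (m≤m⊔n _ _))) (head f))
                                                   (All.map (λ p → ≤-trans p (s≤s (m≤n⊔m _ _))) (All-depth-expand∨ fs))
      where
      head : ∀ f → All (λ g → depth g ≤ suc (depth f)) (expand∨₁ f)
      head (lit l) = All-map-term _ λ {b} _ → depth≡1⇒≤ (term b) (depth-term b) (s≤s z≤n)
      head (⋀ gs) = depth-expand (⋀ gs) ∷ []
      head (⋁ gs) = depth-expand (⋁ gs) ∷ []

  All-1≤depth-expand∧ : ∀ fs → All (λ g → 1 ≤ depth g) (expand∧ fs)
  All-1≤depth-expand∧ [] = []
  All-1≤depth-expand∧ (lit l ∷ fs) =
    ++⁺ (All-map-¬term _ λ {b} _ → ≤-reflexive (sym (depth-¬term b))) (All-1≤depth-expand∧ fs)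
  All-1≤depth-expand∧ (⋀ gs ∷ fs) = s≤s z≤n ∷ All-1≤depth-expand∧ fs
  All-1≤depth-expand∧ (⋁ gs ∷ fs) = s≤s z≤n ∷ All-1≤depth-expand∧ fs

  All-1≤depth-expand∨ : ∀ fs → All (λ g → 1 ≤ depth g) (expand∨ fs)
  All-1≤depth-expand∨ [] = []
  All-1≤depth-expand∨ (lit l ∷ fs) =
    ++⁺ (All-map-term _ λ {b} _ → ≤-reflexive (sym (depth-term b))) (All-1≤depth-expand∨ fs)
  All-1≤depth-expand∨ (⋀ gs ∷ fs) = s≤s z≤n ∷ All-1≤depth-expand∨ fs
  All-1≤depth-expand∨ (⋁ gs ∷ fs) = s≤s z≤n ∷ All-1≤depth-expand∨ fs

  B : ℕ
  B = suc (suc d)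

  accepting-length< : ∀ l {b} → b ∈ accepting (literalTree l) → suc (length b) ≤ B
  accepting-length< l b∈ =
    s≤s (≤-trans (length-∈allPaths (literalTree l) (accepting⊆allPaths (literalTree l) b∈)) (dtDepth-literalTree l))

  rejecting-length< : ∀ l {b} → b ∈ rejecting (literalTree l) → suc (length b) ≤ B
  rejecting-length< l b∈ =
    s≤s (≤-trans (length-∈allPaths (literalTree l) (rejecting⊆allPaths (literalTree l) b∈)) (dtDepth-literalTree l))

  -- An expanded ⋀ or ⋁ has only subformulas of depth ≥ 1, so it has depth 1 only when empty.
  empty-size≤B : ∀ gs → All (λ g → 1 ≤ depth g) gs → suc (depthL gs) ≡ 1 → suc (sizeL gs) ≤ B
  empty-size≤B gs 1≤depths d≡1 with depthL≡0⇒≡[] gs 1≤depths (suc-injective d≡1)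
  ... | refl = s≤s z≤n

  mutual
    Bottom≤-expand : ∀ f → Bottom≤ B (expand f)
    Bottom≤-expand (lit l) = Bottom≤-lit l
    Bottom≤-expand (⋀ fs) = Bottom≤-⋀ (expand∧ fs) (All-Bottom≤-expand∧ fs) (empty-size≤B _ (All-1≤depth-expand∧ fs))
    Bottom≤-expand (⋁ fs) = Bottom≤-⋁ (expand∨ fs) (All-Bottom≤-expand∨ fs) (empty-size≤B _ (All-1≤depth-expand∨ fs))

    All-Bottom≤-expand∧ : ∀ fs → All (Bottom≤ B) (expand∧ fs)
    All-Bottom≤-expand∧ [] = []
    All-Bottom≤-expand∧ (lit l ∷ fs) =
      ++⁺ (All-map-¬term _ λ {b} b∈ → Bottom≤-¬term b (rejecting-length< l b∈)) (All-Bottom≤-expand∧ fs)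
    All-Bottom≤-expand∧ (⋀ gs ∷ fs) = Bottom≤-expand (⋀ gs) ∷ All-Bottom≤-expand∧ fs
    All-Bottom≤-expand∧ (⋁ gs ∷ fs) = Bottom≤-expand (⋁ gs) ∷ All-Bottom≤-expand∧ fs

    All-Bottom≤-expand∨ : ∀ fs → All (Bottom≤ B) (expand∨ fs)
    All-Bottom≤-expand∨ [] = []
    All-Bottom≤-expand∨ (lit l ∷ fs) =
      ++⁺ (All-map-term _ λ {b} b∈ → Bottom≤-term b (accepting-length< l b∈)) (All-Bottom≤-expand∨ fs)
    All-Bottom≤-expand∨ (⋀ gs ∷ fs) = Bottom≤-expand (⋀ gs) ∷ All-Bottom≤-expand∨ fs
    All-Bottom≤-expand∨ (⋁ gs ∷ fs) = Bottom≤-expand (⋁ gs) ∷ All-Bottom≤-expand∨ fs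

  module ExpansionSize (P : ℕ) (2^d≤P : 2 ^ suc d ≤ P) (B≤P : B ≤ P) where

    W : ℕ
    W = P * P

    1≤P : 1 ≤ P
    1≤P = ≤-trans (m^n>0 2 (suc d)) 2^d≤P

    1≤W : 1 ≤ W
    1≤W = *-mono-≤ 1≤P 1≤P

    2^≤P : ∀ {n} → n ≤ suc d → 2 ^ n ≤ P
    2^≤P n≤ = ≤-trans (^-monoʳ-≤ 2 n≤) 2^d≤P

    length-disjuncts : ∀ l → length (disjuncts l) ≤ P
    length-disjuncts l = ≤-trans (≤-reflexive (length-map term (accepting (literalTree l))))
                                 (≤-trans (length-accepting (literalTree l)) (2^≤P (dtDepth-literalTree l)))

    length-conjuncts : ∀ l → length (conjuncts l) ≤ P
    length-conjuncts l = ≤-trans (≤-reflexive (length-map ¬term (rejecting (literalTree l))))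
                                 (≤-trans (length-rejecting (literalTree l)) (2^≤P (dtDepth-literalTree l)))

    sizeL≤length* : ∀ gs → All (λ g → size g ≤ B) gs → sizeL gs ≤ length gs * B
    sizeL≤length* [] [] = z≤n
    sizeL≤length* (g ∷ gs) (p ∷ ps) = +-mono-≤ p (sizeL≤length* gs ps)

    sizeL-disjuncts : ∀ l → sizeL (disjuncts l) ≤ W
    sizeL-disjuncts l =
      ≤-trans (sizeL≤length* _ (All-map-term (accepting (literalTree l)) λ {b} b∈ →
                                  ≤-trans (≤-reflexive (size-term b)) (accepting-length< l b∈)))
                                (*-mono-≤ (length-disjuncts l) B≤P)

    sizeL-conjuncts : ∀ l → sizeL (conjuncts l) ≤ W
    sizeL-conjuncts l =
      ≤-trans (sizeL≤length* _ (All-map-¬term (rejecting (literalTree l)) λ {b} b∈ →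
                                  ≤-trans (≤-reflexive (size-¬term b)) (rejecting-length< l b∈)))
                                (*-mono-≤ (length-conjuncts l) B≤P)

    mutual
      size-expand : ∀ f → size (expand f) ≤ W * size f
      size-expand (lit l) = ≤-trans 1≤W (≤-reflexive (sym (*-identityʳ W)))
      size-expand (⋀ fs) = ≤-trans (+-mono-≤ 1≤W (sizeL-expand∧ fs)) (≤-reflexive (sym (*-suc W (sizeL fs))))
      size-expand (⋁ fs) = ≤-trans (+-mono-≤ 1≤W (sizeL-expand∨ fs)) (≤-reflexive (sym (*-suc W (sizeL fs))))

      sizeL-expand∧ : ∀ fs → sizeL (expand∧ fs) ≤ W * sizeL fs
      sizeL-expand∧ [] = z≤n
      sizeL-expand∧ (lit l ∷ fs) =
        ≤-trans (≤-reflexive (sizeL-++ (conjuncts l) (expand∧ fs)))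
                (≤-trans (+-mono-≤ (sizeL-conjuncts l) (sizeL-expand∧ fs)) (≤-reflexive (sym (*-suc W (sizeL fs)))))
      sizeL-expand∧ (f@(⋀ _) ∷ fs) =
        ≤-trans (+-mono-≤ (size-expand f) (sizeL-expand∧ fs)) (≤-reflexive (sym (*-distribˡ-+ W (size f) (sizeL fs))))
      sizeL-expand∧ (f@(⋁ _) ∷ fs) =
        ≤-trans (+-mono-≤ (size-expand f) (sizeL-expand∧ fs)) (≤-reflexive (sym (*-distribˡ-+ W (size f) (sizeL fs))))

      sizeL-expand∨ : ∀ fs → sizeL (expand∨ fs) ≤ W * sizeL fs
      sizeL-expand∨ [] = z≤n
      sizeL-expand∨ (lit l ∷ fs) =
        ≤-trans (≤-reflexive (sizeL-++ (disjuncts l) (expand∨ fs)))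
                (≤-trans (+-mono-≤ (sizeL-disjuncts l) (sizeL-expand∨ fs)) (≤-reflexive (sym (*-suc W (sizeL fs)))))
      sizeL-expand∨ (f@(⋀ _) ∷ fs) =
        ≤-trans (+-mono-≤ (size-expand f) (sizeL-expand∨ fs)) (≤-reflexive (sym (*-distribˡ-+ W (size f) (sizeL fs))))
      sizeL-expand∨ (f@(⋁ _) ∷ fs) =
        ≤-trans (+-mono-≤ (size-expand f) (sizeL-expand∨ fs)) (≤-reflexive (sym (*-distribˡ-+ W (size f) (sizeL fs))))

    cedentSize-expand∨ : ∀ Γ → cedentSize (expand∨ Γ) ≤ W * cedentSize Γ
    cedentSize-expand∨ Γ = ≤-trans (+-mono-≤ 1≤W (sizeL-expand∨ Γ)) (≤-reflexive (sym (*-suc W (sizeL Γ))))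

    length-expand∧ : ∀ fs → length (expand∧ fs) ≤ length fs * P
    length-expand∧ [] = z≤n
    length-expand∧ (lit l ∷ fs) = ≤-trans (≤-reflexive (length-++ (conjuncts l))) (+-mono-≤ (length-conjuncts l) (length-expand∧ fs))
    length-expand∧ (⋀ gs ∷ fs) = +-mono-≤ 1≤P (length-expand∧ fs)
    length-expand∧ (⋁ gs ∷ fs) = +-mono-≤ 1≤P (length-expand∧ fs)

    module ExpansionSimulation (k Mt : ℕ) (1≤Mt : 1 ≤ Mt) where

      M : ℕ
      M = 4 * P * P + Mt

      Fits : Formula → Set
      Fits f = depth f ≤ suc k × Bottom≤ B f

      Allowed : Cedent → Set
      Allowed Γ = All Fits Γ × cedentSize Γ ≤ M

      open Building F Allowed public

      Small : Formula → Set
      Small f = depth f ≤ 1 × Bottom≤ B f × size f ≤ B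

      record Bounded (j : ℕ) (Δ : Cedent) : Set where
        constructor bounded
        field
          fits  : All Fits Δ
          size≤ : cedentSize Δ ≤ j * B + Mt

      Context : Cedent → Set
      Context = Bounded 0

      Bounded-[] : Bounded 0 []
      Bounded-[] = bounded [] 1≤Mt

      Bounded-∷ : ∀ {j f Δ} → Small f → Bounded j Δ → Bounded (suc j) (f ∷ Δ)
      Bounded-∷ {j} {f} {Δ} (d≤1 , bottom , size≤B) (bounded fits size≤) =
        bounded ((≤-trans d≤1 (s≤s z≤n) , bottom) ∷ fits)
                (≤-trans (≤-reflexive (sym (+-suc (size f) (sizeL Δ))))
                         (≤-trans (+-mono-≤ size≤B size≤) (≤-reflexive (sym (+-assoc B (j * B) Mt)))))

      Bounded-++ : ∀ {j} X {Δ} → All Small X → Bounded j Δ → Bounded (length X + j) (X ++ Δ)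
      Bounded-++ [] [] b = b
      Bounded-++ (x ∷ X) (s ∷ ss) b = Bounded-∷ s (Bounded-++ X ss b)

      Bounded⇒Allowed : ∀ {j Δ} → j ≤ 4 * P → Bounded j Δ → Allowed Δ
      Bounded⇒Allowed j≤ (bounded fits size≤) = fits , ≤-trans size≤ (+-monoˡ-≤ Mt (*-mono-≤ j≤ B≤P))

      Context-suffix : ∀ X {Γt} → Context (X ++ Γt) → Context Γt
      Context-suffix X {Γt} (bounded fits size≤) =
        bounded (++⁻ʳ X fits) (≤-trans (s≤s (≤-trans (m≤n+m (sizeL Γt) (sizeL X)) (≤-reflexive (sym (sizeL-++ X Γt))))) size≤)

      Small-lit : ∀ l → Small (lit l)
      Small-lit l = z≤n , Bottom≤-lit l , ≤-trans (s≤s z≤n) (s≤s (s≤s z≤n))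

      All-Small-lit : ∀ ls → All Small (map lit ls)
      All-Small-lit [] = []
      All-Small-lit (l ∷ ls) = Small-lit l ∷ All-Small-lit ls

      Small-term : ∀ b → suc (length b) ≤ B → Small (term b)
      Small-term b len = ≤-reflexive (depth-term b) , Bottom≤-term b len , ≤-trans (≤-reflexive (size-term b)) len

      Small-¬term : ∀ b → suc (length b) ≤ B → Small (¬term b)
      Small-¬term b len = ≤-reflexive (depth-¬term b) , Bottom≤-¬term b len , ≤-trans (≤-reflexive (size-¬term b)) len

      P≤4P : ∀ {n} → n ≤ P → n ≤ 4 * P
      P≤4P n≤P = ≤-trans n≤P (m≤m+n P (3 * P))

      Allowed-small : ∀ X → All Small X → length X ≤ 4 * P → Allowed X
      Allowed-small X smalls len =
        Bounded⇒Allowed (≤-trans (≤-reflexive (+-identityʳ _)) len)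
          (subst (Bounded (length X + 0)) (++-identityʳ X) (Bounded-++ X smalls Bounded-[]))

      length-map-lit-map-negLit : ∀ ρ → length (map lit (map negLit ρ)) ≡ length ρ
      length-map-lit-map-negLit ρ = trans (length-map lit (map negLit ρ)) (length-map negLit ρ)

      Allowed-axiom : ∀ x → Allowed (lit (pos x) ∷ lit (neg x) ∷ [])
      Allowed-axiom x = Allowed-small _ (All-Small-lit (pos x ∷ neg x ∷ [])) (≤-trans (≤ᵇ⇒≤ 2 4 _) (*-monoʳ-≤ 4 1≤P))

      complementary-axiom : ∀ {l} y Y → y ∈ Y → negLit y ∈ Y → Builds l 1 (λ l′ → Derivable l′ (map lit Y))
      complementary-axiom (pos x) Y y∈ ¬y∈ =
        map-result (Derivable-weaken (∈-∷⁺ʳ (∈-map⁺ lit y∈) (∈-∷⁺ʳ (∈-map⁺ lit ¬y∈) []⊆))) (axiom-line x (Allowed-axiom x))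
      complementary-axiom (neg x) Y y∈ ¬y∈ =
        map-result (Derivable-weaken (∈-∷⁺ʳ (∈-map⁺ lit ¬y∈) (∈-∷⁺ʳ (∈-map⁺ lit y∈) []⊆))) (axiom-line x (Allowed-axiom x))

      term-or-negation : ∀ {l} ρ → suc (length ρ) ≤ B →
                         Builds l (2 * B) (λ l′ → Derivable l′ (term ρ ∷ map lit (map negLit ρ)))
      term-or-negation ρ len = within cost
        (for-each (map lit ρ) (λ f l → Derivable l (f ∷ ¬ρ)) (λ f s d → Derivable-mono s d) literal-or-negation >>= λ _ ds →
         ∧-intro-on ¬ρ (map lit ρ) ds (All.tabulate allowed-literal) (Allowed-small (term ρ ∷ ¬ρ) (Small-term ρ len ∷ All-Small-lit _) ¬ρ-length))
        where
        ¬ρ = map lit (map negLit ρ)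
        ¬ρ-length : suc (length ¬ρ) ≤ 4 * P
        ¬ρ-length = P≤4P (≤-trans (≤-reflexive (cong suc (length-map-lit-map-negLit ρ))) (≤-trans len B≤P))
        literal-or-negation : ∀ {l} f → f ∈ map lit ρ → _ → Builds l 1 (λ l′ → Derivable l′ (f ∷ ¬ρ))
        literal-or-negation f f∈ _ with ∈-map⁻ lit f∈
        ... | y , y∈ , refl = complementary-axiom y (y ∷ map negLit ρ) (here refl) (there (∈-map⁺ negLit y∈))
        allowed-literal : ∀ {f} → f ∈ map lit ρ → Allowed (f ∷ ¬ρ)
        allowed-literal f∈ with ∈-map⁻ lit f∈
        ... | y , _ , refl = Allowed-small (lit y ∷ ¬ρ) (Small-lit y ∷ All-Small-lit _) ¬ρ-length
        n = length (map lit ρ)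
        cost : n * 1 + (n * 1 + 1) ≤ 2 * B
        cost = begin
          n * 1 + (n * 1 + 1)   ≡⟨ cong (λ m → m + (m + 1)) (*-identityʳ n) ⟩
          n + (n + 1)           ≡⟨ cong (n +_) (+-comm n 1) ⟩
          n + suc n             ≤⟨ +-mono-≤ (n≤1+n n) (≤-reflexive (sym (+-identityʳ _))) ⟩
          suc n + (suc n + 0)   ≤⟨ *-monoʳ-≤ 2 (≤-trans (s≤s (≤-reflexive (length-map lit ρ))) len) ⟩
          2 * B                 ∎
          where open ≤-Reasoning

      -- A literal y of a variable of F expands to the one-literal term wrap y, since its tree is varTree.
      wrap : Literal → Formula
      wrap y = term (y ∷ [])

      Small-wrap : ∀ y → Small (wrap y)
      Small-wrap y = Small-term (y ∷ []) (s≤s (s≤s z≤n))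

      All-Small-wrap : ∀ q → All Small (map wrap q)
      All-Small-wrap [] = []
      All-Small-wrap (y ∷ q) = Small-wrap y ∷ All-Small-wrap q

      wrap-literals : ∀ {l} q Δ → All Small Δ → length q + length Δ ≤ P → Derivable l (map lit q ++ Δ) →
                      Builds l (length q * 2) (λ l′ → Derivable l′ (map wrap q ++ Δ))
      wrap-literals [] Δ _ _ d = return d
      wrap-literals (y ∷ q) Δ smallΔ len d = within (≤-reflexive (+-comm (length q * 2) 2))
        (wrap-literals q (lit y ∷ Δ) (Small-lit y ∷ smallΔ) (≤-trans (≤-reflexive (+-suc (length q) (length Δ))) len)
                       (Derivable-weaken (∷-++⊆++-∷ (map lit q) (lit y) Δ) d) >>= λ _ d′ →
         ∧-intro-on (map wrap q ++ Δ) (lit y ∷ []) (Derivable-weaken (++-∷⊆∷-++ (map wrap q) (lit y) Δ) d′ ∷ [])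
           (Allowed-small (lit y ∷ map wrap q ++ Δ) (Small-lit y ∷ rest-small) len′ ∷ [])
           (Allowed-small (wrap y ∷ map wrap q ++ Δ) (Small-wrap y ∷ rest-small) len′))
        where
        rest-small = ++⁺ (All-Small-wrap q) smallΔ
        len′ : suc (length (map wrap q ++ Δ)) ≤ 4 * P
        len′ = P≤4P (≤-trans (≤-reflexive (cong suc (trans (length-++ (map wrap q)) (cong (_+ length Δ) (length-map wrap q))))) len)

      ≤suc-d⇒≤P : ∀ {n} → n ≤ suc d → n ≤ P
      ≤suc-d⇒≤P n≤ = ≤-trans (≤-trans n≤ (n≤1+n _)) B≤P

      pathTerms : List Literal → DTree → List Formula
      pathTerms ρ T = map (λ b → term (ρ ++ b)) (allPaths T)

      All-Small-pathTerms : ∀ ρ T → length ρ + dtDepth T ≤ suc d → All Small (pathTerms ρ T)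
      All-Small-pathTerms ρ T len = All-map⁺ (All.tabulate λ {b} b∈ →
        Small-term (ρ ++ b) (s≤s (≤-trans (≤-reflexive (length-++ ρ)) (≤-trans (+-monoʳ-≤ (length ρ) (length-∈allPaths T b∈)) len))))

      length-pathTerms : ∀ ρ T → dtDepth T ≤ suc d → length (pathTerms ρ T) ≤ P
      length-pathTerms ρ T dT = ≤-trans (≤-reflexive (length-map _ (allPaths T))) (≤-trans (length-allPaths T) (2^≤P dT))

      pathTerms-snoc⊆ : ∀ ρ z t L → (∀ {b} → b ∈ allPaths t → (z ∷ b) ∈ L) →
                        pathTerms (ρ ++ z ∷ []) t ⊆ map (λ b → term (ρ ++ b)) L
      pathTerms-snoc⊆ ρ z t L z∷b∈ g∈ with ∈-map⁻ (λ b → term ((ρ ++ z ∷ []) ++ b)) g∈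
      ... | b , b∈ , refl = subst (_∈ map (λ b → term (ρ ++ b)) L) (cong term (sym (++-assoc ρ (z ∷ []) b)))
                                  (∈-map⁺ (λ b → term (ρ ++ b)) (z∷b∈ b∈))

      ¬snoc⊆ : ∀ ρ z Δ → map lit (map negLit (ρ ++ z ∷ [])) ⊆ lit (negLit z) ∷ (map lit (map negLit ρ) ++ Δ)
      ¬snoc⊆ ρ z Δ = subst (_⊆ lit (negLit z) ∷ (map lit (map negLit ρ) ++ Δ))
                            (sym (trans (cong (map lit) (map-++-snoc negLit ρ z)) (map-++-snoc lit (map negLit ρ) (negLit z))))
                            (⊆-++⁻ (⊆-trans (xs⊆xs++ys _ Δ) there) (∈-∷⁺ʳ (here refl) []⊆))

      cover-length : ∀ ρ T → length ρ + dtDepth T ≤ suc d → suc (length (map lit (map negLit ρ) ++ pathTerms ρ T)) ≤ 4 * P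
      cover-length ρ T len = begin
        suc (length (map lit (map negLit ρ) ++ pathTerms ρ T))
          ≡⟨ cong suc (trans (length-++ (map lit (map negLit ρ))) (cong (_+ length (pathTerms ρ T)) (length-map-lit-map-negLit ρ))) ⟩
        suc (length ρ + length (pathTerms ρ T))
          ≤⟨ s≤s (+-mono-≤ (≤suc-d⇒≤P (≤-trans (m≤m+n _ _) len)) (length-pathTerms ρ T (≤-trans (m≤n+m _ _) len))) ⟩
        suc (P + P)
          ≤⟨ ≤-trans (+-monoˡ-≤ (P + P) 1≤P) (+-monoʳ-≤ P (+-monoʳ-≤ P (m≤m+n P (P + 0)))) ⟩
        4 * P ∎
        where open ≤-Reasoning

      coverCost : DTree → ℕ
      coverCost (leaf _) = 2 * B
      coverCost (node _ t₀ t₁) = coverCost t₀ + (coverCost t₁ + 3)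

      -- The paths of T cover every assignment extending ρ.
      paths-cover : ∀ {l} T ρ → length ρ + dtDepth T ≤ suc d →
                    Builds l (coverCost T) (λ l′ → Derivable l′ (map lit (map negLit ρ) ++ pathTerms ρ T))
      paths-cover (leaf o) ρ len =
        map-result (Derivable-weaken (∈-∷⁺ʳ (∈-++⁺ʳ _ (here (cong term (sym (++-identityʳ ρ))))) (xs⊆xs++ys _ _)))
                   (term-or-negation ρ (s≤s (≤-trans (≤-reflexive (sym (+-identityʳ (length ρ)))) len)))
      paths-cover (node x t₀ t₁) ρ len =
        paths-cover t₀ (ρ ++ neg x ∷ []) (len-child (m≤m⊔n _ _)) >>= λ s₀ d₀ →
        paths-cover t₁ (ρ ++ pos x ∷ []) (len-child (m≤n⊔m _ _)) >>= λ s₁ d₁ →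
        cut-on (lit (pos x)) Δ (Derivable-weaken sub₀ (Derivable-mono s₁ d₀)) (Derivable-weaken sub₁ d₁)
               (Allowed-small _ (Small-lit _ ∷ smallΔ) lenΔ′) (Allowed-small _ (Small-lit _ ∷ smallΔ) lenΔ′)
               (Allowed-small _ smallΔ (≤-trans (n≤1+n _) lenΔ′))
        where
        T = node x t₀ t₁
        Δ = map lit (map negLit ρ) ++ pathTerms ρ T
        len-child : ∀ {z t} → dtDepth t ≤ dtDepth t₀ ⊔ dtDepth t₁ → length (ρ ++ z ∷ []) + dtDepth t ≤ suc d
        len-child {z} {t} dt≤ = begin
          length (ρ ++ z ∷ []) + dtDepth t   ≡⟨ cong (_+ dtDepth t) (trans (length-++ ρ) (+-comm (length ρ) 1)) ⟩
          suc (length ρ) + dtDepth t         ≡⟨ sym (+-suc (length ρ) (dtDepth t)) ⟩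
          length ρ + suc (dtDepth t)         ≤⟨ +-monoʳ-≤ (length ρ) (s≤s dt≤) ⟩
          length ρ + dtDepth T               ≤⟨ len ⟩
          suc d                              ∎
          where open ≤-Reasoning
        sub₀ : map lit (map negLit (ρ ++ neg x ∷ [])) ++ pathTerms (ρ ++ neg x ∷ []) t₀ ⊆ lit (pos x) ∷ Δ
        sub₀ = ⊆-++⁻ (¬snoc⊆ ρ (neg x) (pathTerms ρ T))
                     (⊆-trans (pathTerms-snoc⊆ ρ (neg x) t₀ (allPaths T) (∈-paths-node⁺ˡ _ x t₀ t₁))
                              (⊆-trans (xs⊆ys++xs _ (map lit (map negLit ρ))) there))
        sub₁ : map lit (map negLit (ρ ++ pos x ∷ [])) ++ pathTerms (ρ ++ pos x ∷ []) t₁ ⊆ lit (neg x) ∷ Δ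
        sub₁ = ⊆-++⁻ (¬snoc⊆ ρ (pos x) (pathTerms ρ T))
                     (⊆-trans (pathTerms-snoc⊆ ρ (pos x) t₁ (allPaths T) (∈-paths-node⁺ʳ _ x t₀ t₁))
                              (⊆-trans (xs⊆ys++xs _ (map lit (map negLit ρ))) there))
        smallΔ : All Small Δ
        smallΔ = ++⁺ (All-Small-lit (map negLit ρ)) (All-Small-pathTerms ρ T len)
        lenΔ′ : suc (length Δ) ≤ 4 * P
        lenΔ′ = cover-length ρ T len

      sum3≤4P : ∀ {a b c} → a ≤ P → b ≤ P → c ≤ P → a + (b + c) ≤ 4 * P
      sum3≤4P a≤ b≤ c≤ = ≤-trans (+-mono-≤ a≤ (+-mono-≤ b≤ c≤)) (+-monoʳ-≤ P (+-monoʳ-≤ P (m≤m+n P (P + 0))))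

      length-accepting≤P : ∀ T → dtDepth T ≤ suc d → length (accepting T) ≤ P
      length-accepting≤P T dT = ≤-trans (length-accepting T) (2^≤P dT)

      length-rejecting≤P : ∀ T → dtDepth T ≤ suc d → length (rejecting T) ≤ P
      length-rejecting≤P T dT = ≤-trans (length-rejecting T) (2^≤P dT)

      path-length< : ∀ T → dtDepth T ≤ suc d → ∀ {b} → b ∈ allPaths T → suc (length b) ≤ B
      path-length< T dT b∈ = s≤s (≤-trans (length-∈allPaths T b∈) dT)

      ¬path-length : ∀ T → dtDepth T ≤ suc d → ∀ {b} → b ∈ allPaths T → length (map lit (map negLit b)) ≤ P
      ¬path-length T dT {b} b∈ =
        ≤-trans (≤-reflexive (length-map-lit-map-negLit b)) (≤-trans (n≤1+n _) (≤-trans (path-length< T dT b∈) B≤P))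

      -- Each accepting path a clashes with b, so ¬a ∨ ¬b is an axiom; cutting the term a
      -- against it removes a.
      cut-accepting : ∀ {l} T Γt → Context Γt → dtDepth T ≤ suc d → ∀ {b} → b ∈ rejecting T →
                      ∀ as → as ⊆ accepting T → length as ≤ length (accepting T) →
                      Derivable l (map term as ++ map lit (map negLit b) ++ Γt) →
                      Builds l (length as * 6) (λ l′ → Derivable l′ (map lit (map negLit b) ++ Γt))
      cut-accepting T Γt ctx dT b∈ [] _ _ d = return d
      cut-accepting T Γt ctx dT {b} b∈ (a ∷ as) as⊆ len d with accepting-rejecting-clash T (as⊆ (here refl)) b∈
      ... | y , y∈a , ¬y∈b =
        complementary-axiom y (map negLit a ++ map negLit b)
          (∈-++⁺ʳ _ (subst (_∈ map negLit b) (negLit-involutive y) (∈-map⁺ negLit ¬y∈b))) (∈-++⁺ˡ (∈-map⁺ negLit y∈a)) >>= λ s₁ d-axiom →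
        ∨-intro-on Δ (map lit (map negLit a)) (Derivable-weaken sub-axiom d-axiom) ok-¬a ok-¬term >>= λ s₂ d-¬term →
        cut-on (term a) Δ (Derivable-mono (⊆-trans s₁ s₂) d) (Derivable-resp (sym (dual-term a)) d-¬term)
               ok-term (subst (λ f → Allowed (f ∷ Δ)) (sym (dual-term a)) ok-¬term) ok-Δ >>= λ _ dΔ →
        cut-accepting T Γt ctx dT b∈ as (as⊆ ∘ there) (≤-trans (n≤1+n _) len) dΔ
        where
        ¬b = map lit (map negLit b)
        Δ = map term as ++ ¬b ++ Γt
        a-length< : suc (length a) ≤ B
        a-length< = path-length< T dT (accepting⊆allPaths T (as⊆ (here refl)))
        sub-axiom : map lit (map negLit a ++ map negLit b) ⊆ map lit (map negLit a) ++ Δ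
        sub-axiom = subst (_⊆ map lit (map negLit a) ++ Δ) (sym (map-++ lit (map negLit a) (map negLit b)))
                      (++⁺ʳ (map lit (map negLit a)) (⊆-trans (xs⊆xs++ys _ Γt) (xs⊆ys++xs _ (map term as))))
        as-length : length (map term as) ≤ P
        as-length = ≤-trans (≤-reflexive (length-map term as)) (≤-trans (n≤1+n _) (≤-trans len (length-accepting≤P T dT)))
        ¬b-length : length ¬b + 0 ≤ P
        ¬b-length = ≤-trans (≤-reflexive (+-identityʳ _)) (¬path-length T dT (rejecting⊆allPaths T b∈))
        bΔ : Bounded (length (map term as) + (length ¬b + 0)) Δ
        bΔ = Bounded-++ (map term as) (All-map-term as λ {a′} a′∈ → Small-term a′ (path-length< T dT (accepting⊆allPaths T (as⊆ (there a′∈)))))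
               (Bounded-++ ¬b (All-Small-lit _) ctx)
        ok-Δ : Allowed Δ
        ok-Δ = Bounded⇒Allowed (sum3≤4P as-length (¬path-length T dT (rejecting⊆allPaths T b∈)) z≤n) bΔ
        ok-¬a : Allowed (map lit (map negLit a) ++ Δ)
        ok-¬a = Bounded⇒Allowed (sum3≤4P (¬path-length T dT (accepting⊆allPaths T (as⊆ (here refl)))) as-length ¬b-length)
                                (Bounded-++ (map lit (map negLit a)) (All-Small-lit _) bΔ)
        ok-¬term : Allowed (¬term a ∷ Δ)
        ok-¬term = Bounded⇒Allowed (sum3≤4P 1≤P as-length ¬b-length) (Bounded-∷ (Small-¬term a a-length<) bΔ)
        ok-term : Allowed (term a ∷ Δ)
        ok-term = Bounded⇒Allowed (sum3≤4P 1≤P as-length ¬b-length) (Bounded-∷ (Small-term a a-length<) bΔ)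

      reject-from-accepting : ∀ {l} T Γt → Context Γt → dtDepth T ≤ suc d → ∀ {b} → b ∈ rejecting T →
                              Derivable l (map term (accepting T) ++ Γt) →
                              Builds l (length (accepting T) * 6 + 2) (λ l′ → Derivable l′ (¬term b ∷ Γt))
      reject-from-accepting T Γt ctx dT {b} b∈ d =
        cut-accepting T Γt ctx dT b∈ (accepting T) ⊆-refl ≤-refl
          (Derivable-weaken (++⁺ʳ (map term (accepting T)) (xs⊆ys++xs Γt _)) d) >>= λ _ d′ →
        ∨-intro-on Γt (map lit (map negLit b)) d′
          (Bounded⇒Allowed (sum3≤4P (¬path-length T dT (rejecting⊆allPaths T b∈)) z≤n z≤n)
                           (Bounded-++ (map lit (map negLit b)) (All-Small-lit _) ctx))
          (Bounded⇒Allowed (P≤4P 1≤P) (Bounded-∷ (Small-¬term b (path-length< T dT (rejecting⊆allPaths T b∈))) ctx))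

      cut-tree : ∀ {l} T Γt → Context Γt → dtDepth T ≤ suc d →
                 Derivable l (map term (accepting T) ++ Γt) → Derivable l (map term (rejecting T) ++ Γt) →
                 Builds l (length (rejecting T) * (length (accepting T) * 6 + 2 + 3)) (λ l′ → Derivable l′ Γt)
      cut-tree T Γt ctx dT dA dR = cut-rejecting (rejecting T) ⊆-refl ≤-refl dA dR
        where
        c = length (accepting T) * 6 + 2
        cut-rejecting : ∀ {l} rs → rs ⊆ rejecting T → length rs ≤ length (rejecting T) →
                        Derivable l (map term (accepting T) ++ Γt) → Derivable l (map term rs ++ Γt) →
                        Builds l (length rs * (c + 3)) (λ l′ → Derivable l′ Γt)
        cut-rejecting [] _ _ _ d = return d
        cut-rejecting (r ∷ rs) rs⊆ len dA d = within (≤-reflexive (sym (+-assoc c 3 _)))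
          (reject-from-accepting T Γt ctx dT (rs⊆ (here refl)) dA >>= λ s₁ d-¬r →
           cut-on (term r) Δ (Derivable-mono s₁ d)
                  (Derivable-weaken (∷⁺ʳ _ (xs⊆ys++xs Γt (map term rs))) (Derivable-resp (sym (dual-term r)) d-¬r))
                  (Bounded⇒Allowed bound (Bounded-∷ (Small-term r r-length<) bΔ))
                  (subst (λ f → Allowed (f ∷ Δ)) (sym (dual-term r)) (Bounded⇒Allowed bound (Bounded-∷ (Small-¬term r r-length<) bΔ)))
                  (Bounded⇒Allowed (≤-trans (n≤1+n _) bound) bΔ) >>= λ s₂ d′ →
           cut-rejecting rs (rs⊆ ∘ there) (≤-trans (n≤1+n _) len) (Derivable-mono (⊆-trans s₁ s₂) dA) d′)
          where
          Δ = map term rs ++ Γt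
          r-length< : suc (length r) ≤ B
          r-length< = path-length< T dT (rejecting⊆allPaths T (rs⊆ (here refl)))
          bΔ : Bounded (length (map term rs) + 0) Δ
          bΔ = Bounded-++ (map term rs)
                 (All-map-term rs λ {r′} r′∈ → Small-term r′ (path-length< T dT (rejecting⊆allPaths T (rs⊆ (there r′∈))))) ctx
          rs-length : length (map term rs) ≤ P
          rs-length = ≤-trans (≤-reflexive (length-map term rs)) (≤-trans (n≤1+n _) (≤-trans len (length-rejecting≤P T dT)))
          bound : suc (length (map term rs) + 0) ≤ 4 * P
          bound = sum3≤4P 1≤P rs-length z≤n

      lastLit : ℕ → Bool → Literal
      lastLit e true = pos e
      lastLit e false = neg e

      branchAxiom≡ : ∀ e b o → branchAxiom e (b , o) ≡ map negLit b ++ lastLit e o ∷ []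
      branchAxiom≡ e b true = refl
      branchAxiom≡ e b false = refl

      term∈disjuncts-lastLit : ∀ {T e} b o → (T , e) ∈ A → (b , o) ∈ branches T → term b ∈ disjuncts (lastLit e o)
      term∈disjuncts-lastLit {T} b true Te∈ br∈ rewrite treeOf-extension {F} {d} A valid Te∈ =
        ∈-map⁺ term (branch⇒∈paths T br∈ (here refl))
      term∈disjuncts-lastLit {T} b false Te∈ br∈ rewrite treeOf-extension {F} {d} A valid Te∈ | accepting-negateTree T =
        ∈-map⁺ term (branch⇒∈paths T br∈ (here refl))

      wrap∈expand∨ : ∀ {y Γ} → var y ∈ vars F → lit y ∈ Γ → wrap y ∈ expand∨ Γ
      wrap∈expand∨ {y} y∈F y∈Γ =
        expand∨₁⊆expand∨ y∈Γ (subst (wrap y ∈_) (sym (cong (map term) (accepting-literalTree-original y y∈F))) (here refl))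

      clause-expanded : ∀ {l} C → C ∈ F → length C ≤ P →
                        Builds l (1 + length C * 2) (λ l′ → Derivable l′ (expand∨ (clauseCedent C)))
      clause-expanded C C∈ lenC =
        hyp-line C∈ (Allowed-small (map lit C) (All-Small-lit C) (P≤4P (≤-trans (≤-reflexive (length-map lit C)) lenC))) >>= λ _ d →
        map-result (Derivable-weaken (⊆-++⁻ wrapped []⊆))
          (wrap-literals C [] [] (≤-trans (≤-reflexive (+-identityʳ _)) lenC) (Derivable-weaken (xs⊆xs++ys _ []) d))
        where
        wrapped : map wrap C ⊆ expand∨ (clauseCedent C)
        wrapped g∈ with ∈-map⁻ wrap g∈
        ... | y , y∈ , refl = wrap∈expand∨ (var∈vars C∈ y∈) (∈-map⁺ lit y∈)

      -- The expansion of ¬b ∨ e_T is (the wrapped literals of ¬b) ∨ (a disjunction containing the term b),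
      -- a weakening of b ∨ ¬b.
      branch-length< : ∀ {T e b o} → (T , e) ∈ A → (b , o) ∈ branches T → suc (length b) ≤ B
      branch-length< {T} Te∈ br∈ =
        s≤s (≤-trans (length-∈allPaths T (branch⇒∈paths T br∈ (here refl)))
                     (≤-trans (proj₁ (proj₂ (All.lookup (proj₁ valid) Te∈))) (n≤1+n d)))

      extension-axiom-expanded : ∀ {l} T e b o → (T , e) ∈ A → (b , o) ∈ branches T →
                                 Builds l (2 * B + length (map negLit b) * 2)
                                          (λ l′ → Derivable l′ (expand∨ (clauseCedent (branchAxiom e (b , o)))))
      extension-axiom-expanded T e b o Te∈ br∈ =
        term-or-negation b b-length< >>= λ _ d →
        map-result (Derivable-weaken (subst (λ C → _ ⊆ expand∨ (clauseCedent C)) (sym (branchAxiom≡ e b o)) sub))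
          (wrap-literals (map negLit b) (term b ∷ []) (Small-term b b-length< ∷ []) len
            (Derivable-weaken (∈-∷⁺ʳ (∈-++⁺ʳ _ (here refl)) (xs⊆xs++ys _ _)) d))
        where
        T-ok = All.lookup (proj₁ valid) Te∈
        b∈ : b ∈ allPaths T
        b∈ = branch⇒∈paths T br∈ (here refl)
        b-length< : suc (length b) ≤ B
        b-length< = branch-length< Te∈ br∈
        len : length (map negLit b) + length (term b ∷ []) ≤ P
        len = ≤-trans (≤-reflexive (trans (cong (_+ 1) (length-map negLit b)) (+-comm (length b) 1))) (≤-trans b-length< B≤P)
        var¬b∈ : ∀ {y} → y ∈ map negLit b → var y ∈ vars F
        var¬b∈ y∈ with ∈-map⁻ negLit y∈
        ... | z , z∈ , refl = subst (_∈ vars F) (sym (var-negLit z)) (All.lookup (proj₁ T-ok) (var∈queries T b∈ z∈))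
        C = map negLit b ++ lastLit e o ∷ []
        sub : map wrap (map negLit b) ++ term b ∷ [] ⊆ expand∨ (clauseCedent C)
        sub = ⊆-++⁻ wrapped (∈-∷⁺ʳ (expand∨₁⊆expand∨ (∈-map⁺ lit (∈-++⁺ʳ (map negLit b) (here refl))) (term∈disjuncts-lastLit b o Te∈ br∈)) []⊆)
          where
          wrapped : map wrap (map negLit b) ⊆ expand∨ (clauseCedent C)
          wrapped g∈ with ∈-map⁻ wrap g∈
          ... | y , y∈ , refl = wrap∈expand∨ (var¬b∈ y∈) (∈-map⁺ lit (∈-++⁺ˡ y∈))

      -- The expansion of p ∨ ¬p is the disjunction of all path terms of the tree of p.
      axiom-expanded : ∀ {l} p → Builds l (coverCost (treeOf A p)) (λ l′ → Derivable l′ (expand∨ (lit (pos p) ∷ lit (neg p) ∷ [])))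
      axiom-expanded p = map-result (Derivable-weaken sub) (paths-cover T [] (dtDepth-treeOf {F} {d} A valid p))
        where
        T = treeOf A p
        sub : [] ++ pathTerms [] T ⊆ disjuncts (pos p) ++ (disjuncts (neg p) ++ [])
        sub g∈ with ∈-map⁻ (λ b → term ([] ++ b)) g∈
        ... | b , b∈ , refl with ∈-++⁻ (accepting T) (allPaths⊆accepting++rejecting T b∈)
        ...   | inj₁ acc = ∈-++⁺ˡ (∈-map⁺ term acc)
        ...   | inj₂ rej = ∈-++⁺ʳ (disjuncts (pos p))
                             (∈-++⁺ˡ (subst (λ bs → term b ∈ map term bs) (sym (accepting-negateTree T)) (∈-map⁺ term rej)))

      conjuncts-from-disjuncts : ∀ {l} lt Γt → Context Γt → Derivable l (disjuncts lt ++ Γt) →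
                                 Builds l (P * (P * 6 + 2)) (λ l′ → All (λ g → Derivable l′ (g ∷ Γt)) (conjuncts lt))
      conjuncts-from-disjuncts lt Γt ctx d =
        within (*-mono-≤ (length-rejecting≤P T dT) (+-monoˡ-≤ 2 (*-monoˡ-≤ 6 (length-accepting≤P T dT))))
          (map-result All-map⁺
            (for-each (rejecting T) (λ b l → Derivable l (¬term b ∷ Γt)) (λ b s → Derivable-mono s)
              (λ b b∈ s → reject-from-accepting T Γt ctx dT b∈ (Derivable-mono s d))))
        where
        T = literalTree lt
        dT = dtDepth-literalTree lt

      coverCost+3≤ : ∀ T → coverCost T + 3 ≤ (2 * B + 3) * 2 ^ dtDepth T
      coverCost+3≤ (leaf o) = ≤-reflexive (sym (*-identityʳ _))
      coverCost+3≤ (node x t₀ t₁) = begin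
        coverCost t₀ + (coverCost t₁ + 3) + 3      ≡⟨ regroup (coverCost t₀) (coverCost t₁) ⟩
        (coverCost t₀ + 3) + (coverCost t₁ + 3)    ≤⟨ +-mono-≤ (≤-trans (coverCost+3≤ t₀) (*-monoʳ-≤ c (^-monoʳ-≤ 2 (m≤m⊔n (dtDepth t₀) (dtDepth t₁)))))
                                                              (≤-trans (coverCost+3≤ t₁) (*-monoʳ-≤ c (^-monoʳ-≤ 2 (m≤n⊔m (dtDepth t₀) (dtDepth t₁))))) ⟩
        c * 2 ^ m + c * 2 ^ m                      ≡⟨ sym (trans (*-distribˡ-+ c (2 ^ m) (2 ^ m + 0))
                                                                   (cong (λ z → c * 2 ^ m + c * z) (+-identityʳ (2 ^ m)))) ⟩
        c * 2 ^ suc m                              ∎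
        where
        open ≤-Reasoning
        c = 2 * B + 3
        m = dtDepth t₀ ⊔ dtDepth t₁
        regroup : ∀ a b → a + (b + 3) + 3 ≡ (a + 3) + (b + 3)
        regroup = solve 2 (λ a b → a :+ (b :+ con 3) :+ con 3 := (a :+ con 3) :+ (b :+ con 3)) refl
          where open +-*-Solver

      module Costs (32≤P : 32 ≤ P) where

        open PowerBounds P (≤-trans (≤ᵇ⇒≤ 2 32 _) 32≤P) public

        const≤P^ : ∀ {c} a → c ≤ 32 → c ≤ P ^ suc a
        const≤P^ a c≤ = ≤P^-mono {a = 1} {b = suc a} (≤P^1 (≤-trans c≤ 32≤P)) (s≤s z≤n)

        perInference : ℕ
        perInference = P ^ 6

        *6+2≤P^3 : ∀ {x} → x ≤ P → x * 6 + 2 ≤ P ^ 3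
        *6+2≤P^3 x≤ = +-≤P^ {a = 2} (*-≤P^ {a = 1} {b = 1} (≤P^1 x≤) (const≤P^ 0 (≤ᵇ⇒≤ 6 32 _))) (const≤P^ 1 (≤ᵇ⇒≤ 2 32 _))

        tree-cut-cost : ∀ T → dtDepth T ≤ suc d → length (rejecting T) * (length (accepting T) * 6 + 2 + 3) ≤ perInference
        tree-cut-cost T dT =
          ≤P^-mono {a = 5} (*-≤P^ {a = 1} {b = 4} (≤P^1 (length-rejecting≤P T dT))
                            (+-≤P^ {a = 3} (*6+2≤P^3 (length-accepting≤P T dT)) (const≤P^ 2 (≤ᵇ⇒≤ 3 32 _))))
                           (n≤1+n 5)

        cover-cost : ∀ T → dtDepth T ≤ suc d → coverCost T ≤ perInference
        cover-cost T dT = begin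
          coverCost T                  ≤⟨ m≤m+n _ 3 ⟩
          coverCost T + 3              ≤⟨ coverCost+3≤ T ⟩
          (2 * B + 3) * 2 ^ dtDepth T  ≤⟨ *-≤P^ {a = 3} {b = 1}
                                            (+-≤P^ {a = 2} (*-≤P^ {a = 1} {b = 1} (const≤P^ 0 (≤ᵇ⇒≤ 2 32 _)) (≤P^1 B≤P))
                                                           (const≤P^ 1 (≤ᵇ⇒≤ 3 32 _)))
                                            (≤P^1 (2^≤P dT)) ⟩
          P ^ 4                        ≤⟨ ^-monoʳ-≤ P (≤ᵇ⇒≤ 4 6 _) ⟩
          perInference                 ∎
          where open ≤-Reasoning

      module LineSimulation (32≤P : 32 ≤ P) (Lπ : List Cedent)
                            (depth≤ : ∀ Γ f → Γ ∈ Lπ → f ∈ Γ → depth f ≤ k)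
                            (size≤ : ∀ Γ → Γ ∈ Lπ → cedentSize Γ ≤ P)
                            (W*size≤ : ∀ Γ → Γ ∈ Lπ → W * cedentSize Γ ≤ Mt) where

        Context-expand∨ : ∀ {Γ} → Γ ∈ Lπ → Context (expand∨ Γ)
        Context-expand∨ {Γ} Γ∈ = bounded
          (All.zip (All.map (λ p → ≤-trans p (s≤s (All⇒depthL≤ Γ (All.tabulate (λ {f} f∈ → depth≤ Γ f Γ∈ f∈))))) (All-depth-expand∨ Γ) ,
                    All-Bottom≤-expand∨ Γ))
          (≤-trans (cedentSize-expand∨ Γ) (W*size≤ Γ Γ∈))

        Allowed-expand∨ : ∀ {Γ} → Γ ∈ Lπ → Allowed (expand∨ Γ)
        Allowed-expand∨ Γ∈ = Bounded⇒Allowed z≤n (Context-expand∨ Γ∈)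

        open Costs 32≤P

        small≤perInference : ∀ {c} → c ≤ 32 → c ≤ perInference
        small≤perInference = const≤P^ 5

        simulate-⋀ : ∀ {prev Γ fs l} → (⋀ fs ∷ Γ) ∈ Lπ → prev ⊆ Lπ → All (λ f → (f ∷ Γ) ∈ prev) fs →
                     Simulated expand∨ prev l → Builds l perInference (λ l′ → Derivable l′ (⋀ (expand∧ fs) ∷ expand∨ Γ))
        simulate-⋀ {prev} {Γ} {fs} {l} Γ∈ prev⊆ prems sim = within cost
          (for-each fs (λ f l′ → All (λ g → Derivable l′ (g ∷ Γt)) (expand∧₁ f)) (λ f s → All.map (Derivable-mono s))
                    conjunct-premises >>= λ _ ds →
           ∧-intro-on Γt (expand∧ fs) (All-expand∧⁺ fs ds) (All-expand∧⁺ fs (All.tabulate allowed)) (Allowed-expand∨ Γ∈))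
          where
          Γt = expand∨ Γ
          ctx : Context Γt
          ctx = Context-suffix (expand∨₁ (⋀ fs)) (Context-expand∨ Γ∈)
          conjunct-premises : ∀ {l′} f → f ∈ fs → l ⊆ l′ →
                              Builds l′ (P * (P * 6 + 2)) (λ l″ → All (λ g → Derivable l″ (g ∷ Γt)) (expand∧₁ f))
          conjunct-premises (lit lt) f∈ s = conjuncts-from-disjuncts lt Γt ctx (Derivable-mono s (sim (All.lookup prems f∈)))
          conjunct-premises (⋀ gs) f∈ s = within z≤n (return (Derivable-mono s (sim (All.lookup prems f∈)) ∷ []))
          conjunct-premises (⋁ gs) f∈ s = within z≤n (return (Derivable-mono s (sim (All.lookup prems f∈)) ∷ []))
          allowed : ∀ {f} → f ∈ fs → All (λ g → Allowed (g ∷ Γt)) (expand∧₁ f)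
          allowed {lit lt} _ = All-map-¬term _ λ {b} b∈ →
            Bounded⇒Allowed (P≤4P 1≤P) (Bounded-∷ (Small-¬term b (rejecting-length< lt b∈)) ctx)
          allowed {⋀ gs} f∈ = Allowed-expand∨ (prev⊆ (All.lookup prems f∈)) ∷ []
          allowed {⋁ gs} f∈ = Allowed-expand∨ (prev⊆ (All.lookup prems f∈)) ∷ []
          fs≤P : length fs ≤ P
          fs≤P = ≤-trans (length≤sizeL fs) (≤-trans (≤-trans (m≤m+n (sizeL fs) (sizeL Γ)) (≤-trans (n≤1+n _) (n≤1+n _))) (size≤ _ Γ∈))
          cost : length fs * (P * (P * 6 + 2)) + (length (expand∧ fs) * 1 + 1) ≤ perInference
          cost = +-≤P^ {a = 5}
            (*-≤P^ {a = 1} {b = 4} (≤P^1 fs≤P) (*-≤P^ {a = 1} {b = 3} (≤P^1 ≤-refl) (*6+2≤P^3 ≤-refl)))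
            (≤P^-mono {a = 3} (+-≤P^ {a = 2}
               (≤-trans (≤-reflexive (*-identityʳ _)) (≤-trans (length-expand∧ fs) (*-≤P^ {a = 1} {b = 1} (≤P^1 fs≤P) (≤P^1 ≤-refl))))
               (const≤P^ 1 (≤ᵇ⇒≤ 1 32 _))) (≤ᵇ⇒≤ 3 5 _))

        cut-expanded : ∀ {l} A Γ → Derivable l (expand A ∷ expand∨ Γ) → Derivable l (expand (dual A) ∷ expand∨ Γ) →
                       Allowed (expand A ∷ expand∨ Γ) → Allowed (expand (dual A) ∷ expand∨ Γ) → Allowed (expand∨ Γ) →
                       Builds l 3 (λ l′ → Derivable l′ (expand∨ Γ))
        cut-expanded A Γ d₁ d₂ ok₁ ok₂ ok =
          cut-on (expand A) (expand∨ Γ) d₁ (Derivable-resp (expand-dual A) d₂) ok₁ (subst (λ f → Allowed (f ∷ expand∨ Γ)) (expand-dual A) ok₂) ok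

        simulate-inference : ∀ {prev Γ l} → Inference (F ++ extAxioms A) prev Γ → prev ⊆ Lπ → Γ ∈ Lπ →
                             Simulated expand∨ prev l → Builds l perInference (λ l′ → Derivable l′ (expand∨ Γ))
        simulate-inference (axiom p) _ _ _ = within (cover-cost _ (dtDepth-treeOf {F} {d} A valid p)) (axiom-expanded p)
        simulate-inference (hyp {C} C∈) _ Γ∈ _ with ∈-++⁻ F C∈
        ... | inj₁ C∈F = within cost (clause-expanded C C∈F C≤P)
          where
          C≤P : length C ≤ P
          C≤P = ≤-trans (≤-trans (≤-reflexive (sym (sizeL-map-lit C))) (n≤1+n _)) (size≤ _ Γ∈)
          cost : 1 + length C * 2 ≤ perInference
          cost = ≤P^-mono {a = 3} (+-≤P^ {a = 2} (const≤P^ 1 (≤ᵇ⇒≤ 1 32 _)) (*-≤P^ {a = 1} {b = 1} (≤P^1 C≤P) (const≤P^ 0 (≤ᵇ⇒≤ 2 32 _))))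
                                  (≤ᵇ⇒≤ 3 6 _)
        ... | inj₂ C∈ext with ∈-extAxioms⁻ A C∈ext
        ...   | T , e , Te∈ , (b , o) , br∈ , refl = within cost (extension-axiom-expanded T e b o Te∈ br∈)
          where
          cost : 2 * B + length (map negLit b) * 2 ≤ perInference
          cost = ≤P^-mono {a = 3} (+-≤P^ {a = 2}
                   (*-≤P^ {a = 1} {b = 1} (const≤P^ 0 (≤ᵇ⇒≤ 2 32 _)) (≤P^1 B≤P))
                   (*-≤P^ {a = 1} {b = 1} (≤P^1 (≤-trans (≤-reflexive (length-map negLit b)) (≤-trans (n≤1+n _) (≤-trans (branch-length< Te∈ br∈) B≤P))))
                                          (const≤P^ 0 (≤ᵇ⇒≤ 2 32 _))))
                   (≤ᵇ⇒≤ 3 6 _)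
        simulate-inference (weak Γ′∈ Γ′⊆) _ _ sim = within z≤n (return (Derivable-weaken (expand∨-⊆ Γ′⊆) (sim Γ′∈)))
        simulate-inference (cut Γ (lit lt) A∈ ¬A∈) prev⊆ _ sim =
          within (tree-cut-cost T dT)
            (cut-tree T (expand∨ Γ) (Context-suffix (disjuncts lt) (Context-expand∨ (prev⊆ A∈))) dT (sim A∈)
              (subst (λ bs → Derivable _ (map term bs ++ expand∨ Γ)) (accepting-literalTree-negLit lt) (sim ¬A∈)))
          where
          T = literalTree lt
          dT = dtDepth-literalTree lt
        simulate-inference (cut Γ A@(⋀ _) A∈ ¬A∈) prev⊆ Γ∈ sim =
          within (small≤perInference (≤ᵇ⇒≤ 3 32 _))
            (cut-expanded A Γ (sim A∈) (sim ¬A∈) (Allowed-expand∨ (prev⊆ A∈)) (Allowed-expand∨ (prev⊆ ¬A∈)) (Allowed-expand∨ Γ∈))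
        simulate-inference (cut Γ A@(⋁ _) A∈ ¬A∈) prev⊆ Γ∈ sim =
          within (small≤perInference (≤ᵇ⇒≤ 3 32 _))
            (cut-expanded A Γ (sim A∈) (sim ¬A∈) (Allowed-expand∨ (prev⊆ A∈)) (Allowed-expand∨ (prev⊆ ¬A∈)) (Allowed-expand∨ Γ∈))
        simulate-inference (∨-intro Γ fs prem) prev⊆ Γ∈ sim =
          within (small≤perInference (≤ᵇ⇒≤ 2 32 _))
            (∨-intro-on (expand∨ Γ) (expand∨ fs) (subst (Derivable _) (expand∨-++ fs Γ) (sim prem))
              (subst Allowed (expand∨-++ fs Γ) (Allowed-expand∨ (prev⊆ prem))) (Allowed-expand∨ Γ∈))
        simulate-inference (∧-intro Γ fs prems) prev⊆ Γ∈ sim = simulate-⋀ Γ∈ prev⊆ prems sim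


[2^[L+3]]^n≤[2^L]^[4n] : ∀ L n → 1 ≤ L → (2 ^ (L + 3)) ^ n ≤ (2 ^ L) ^ (4 * n)
[2^[L+3]]^n≤[2^L]^[4n] L n 1≤L = begin
  (2 ^ (L + 3)) ^ n    ≡⟨ ^-*-assoc 2 (L + 3) n ⟩
  2 ^ ((L + 3) * n)    ≤⟨ ^-monoʳ-≤ 2 (*-monoˡ-≤ n L+3≤L*4) ⟩
  2 ^ (L * 4 * n)      ≡⟨ cong (2 ^_) (*-assoc L 4 n) ⟩
  2 ^ (L * (4 * n))    ≡⟨ sym (^-*-assoc 2 L (4 * n)) ⟩
  (2 ^ L) ^ (4 * n)    ∎
  where
  open ≤-Reasoning
  L+3≤L*4 : L + 3 ≤ L * 4
  L+3≤L*4 = ≤-trans (+-monoʳ-≤ L (*-monoˡ-≤ 3 1≤L)) (≤-reflexive (sym (*-suc L 3)))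

module ExpandedRefutation {k F s A} (π : Refutation (F ++ extAxioms A)) (valid : ValidExt F ⌊log₂ refSize π ⌋ A)
                          (LK : IsLK k π) (π≤s : refSize π ≤ s) ([]∉F : ¬ ([] ∈ F)) where

  d : ℕ
  d = ⌊log₂ refSize π ⌋

  []∉Ax : ¬ ([] ∈ F ++ extAxioms A)
  []∉Ax []∈ with ∈-++⁻ F []∈
  ... | inj₁ []∈F = []∉F []∈F
  ... | inj₂ []∈A = []∉extAxioms A []∈A

  2≤refSize-π : 2 ≤ refSize π
  2≤refSize-π = 2≤refSize π []∉Ax

  2≤s : 2 ≤ s
  2≤s = ≤-trans 2≤refSize-π π≤s

  L : ℕ
  L = suc ⌊log₂ s ⌋

  P : ℕ
  P = 2 ^ (L + 3)

  2^L≤P : 2 ^ L ≤ P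
  2^L≤P = ^-monoʳ-≤ 2 (m≤m+n L 3)

  s<P : s < P
  s<P = ≤-trans (<2^suc⌊log₂⌋ s) 2^L≤P

  1+d≤L : suc d ≤ L
  1+d≤L = s≤s (⌊log₂⌋-mono-≤ π≤s)

  2^d≤P : 2 ^ suc d ≤ P
  2^d≤P = ≤-trans (^-monoʳ-≤ 2 1+d≤L) 2^L≤P

  B≤P : suc (suc d) ≤ P
  B≤P = ≤-trans (s≤s 1+d≤L) (≤-trans (≤-trans (≤-reflexive (+-comm 1 L)) (+-monoʳ-≤ L (s≤s (z≤n {2})))) (<⇒≤ (n<2^n (L + 3))))

  32≤P : 32 ≤ P
  32≤P = ^-monoʳ-≤ 2 {5} (+-monoˡ-≤ 3 (s≤s (1≤⌊log₂⌋ 2≤s)))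

  open Expansion F A d valid public
  open ExpansionSize P 2^d≤P B≤P public

  Mt : ℕ
  Mt = W * s

  open ExpansionSimulation k Mt (*-mono-≤ 1≤W (≤-trans (s≤s z≤n) 2≤s)) public

  size≤P : ∀ Γ → Γ ∈ lines π → cedentSize Γ ≤ P
  size≤P Γ Γ∈ = ≤-trans (≤-trans (cedentSize≤proofSize (lines π) Γ∈) π≤s) (<⇒≤ s<P)

  W*size≤Mt : ∀ Γ → Γ ∈ lines π → W * cedentSize Γ ≤ Mt
  W*size≤Mt Γ Γ∈ = *-monoʳ-≤ W (≤-trans (cedentSize≤proofSize (lines π) Γ∈) π≤s)

  open LineSimulation 32≤P (lines π) LK size≤P W*size≤Mt public
  open Costs 32≤P public

  built : Extended [] (length (lines π) * perInference) (λ l → Derivable l [])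
  built = map-result (λ sim → sim (here refl)) (simulate expand∨ simulate-inference (deriv π) ⊆-refl) [] []

  padding : ℕ
  padding = 2 * (2 * refSize π)

  π′ : Refutation F
  π′ = refutation-from built padding

  B≤⌊log₂π′⌋ : B ≤ ⌊log₂ refSize π′ ⌋
  B≤⌊log₂π′⌋ = begin
    B                                 ≡⟨ sym (trans (⌊log₂[2*b]⌋≡1+⌊log₂b⌋ (2 * refSize π) {{nonZero-2π}})
                                                    (cong suc (⌊log₂[2*b]⌋≡1+⌊log₂b⌋ (refSize π) {{nonZero-π}}))) ⟩
    ⌊log₂ padding ⌋                   ≤⟨ ⌊log₂⌋-mono-≤ (≤-trans (m≤m+n padding _) (n≤1+n _)) ⟩
    ⌊log₂ suc (padding + proofSize (Extended.lines′ built)) ⌋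
                                      ≡⟨ cong ⌊log₂_⌋ (sym (refSize-refutation-from built padding)) ⟩
    ⌊log₂ refSize π′ ⌋                ∎
    where
    open ≤-Reasoning
    nonZero-π : NonZero (refSize π)
    nonZero-π = >-nonZero (≤-trans (s≤s z≤n) 2≤refSize-π)
    nonZero-2π : NonZero (2 * refSize π)
    nonZero-2π = >-nonZero (*-mono-≤ (s≤s (z≤n {1})) (≤-trans (s≤s z≤n) 2≤refSize-π))

  π′-LKHalf : IsLKHalf k π′
  π′-LKHalf =
    (λ Γ f Γ∈ f∈ → formula-of-refutation-from built padding (λ ok f∈ → proj₁ (All.lookup (proj₁ ok) f∈)) Γ∈ f∈) ,
    (λ Γ f g Γ∈ f∈ g≼f d≡1 → ≤-trans (formula-of-refutation-from built padding {Bottom≤ B}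
                                        (λ ok f∈ → proj₂ (All.lookup (proj₁ ok) f∈)) Γ∈ f∈ g g≼f d≡1)
                                      B≤⌊log₂π′⌋)

  π′-size : refSize π′ ≤ qpoly 9 s
  π′-size = ≤qpoly9 s (refSize π′) 52 2≤s (≤ᵇ⇒≤ 52 256 _) (begin
    refSize π′                              ≡⟨ refSize-refutation-from built padding ⟩
    suc (padding + proofSize lines′)        ≤⟨ +-≤P^ {a = 12} (const≤P^ 11 (≤ᵇ⇒≤ 1 32 _))
                                                 (+-≤P^ {a = 11} (≤P^-mono {a = 3} padding≤ (≤ᵇ⇒≤ 3 11 _)) lines′-size) ⟩
    P ^ 13                                  ≤⟨ [2^[L+3]]^n≤[2^L]^[4n] L 13 (s≤s z≤n) ⟩
    (2 ^ L) ^ 52                            ∎)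
    where
    open ≤-Reasoning
    open Extended built
    s≤P^1 : s ≤ P ^ 1
    s≤P^1 = ≤P^1 (<⇒≤ s<P)
    padding≤ : padding ≤ P ^ 3
    padding≤ = *-≤P^ {a = 1} {b = 2} (const≤P^ 0 (≤ᵇ⇒≤ 2 32 _))
                 (*-≤P^ {a = 1} {b = 1} (const≤P^ 0 (≤ᵇ⇒≤ 2 32 _)) (≤-trans π≤s (≤P^1 (<⇒≤ s<P))))
    M≤ : M ≤ P ^ 4
    M≤ = +-≤P^ {a = 3} (*-≤P^ {a = 2} {b = 1} (*-≤P^ {a = 1} {b = 1} (const≤P^ 0 (≤ᵇ⇒≤ 4 32 _)) (≤P^1 ≤-refl)) (≤P^1 ≤-refl))
                       (*-≤P^ {a = 2} {b = 1} (*-≤P^ {a = 1} {b = 1} (≤P^1 ≤-refl) (≤P^1 ≤-refl)) s≤P^1)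
    lines′-size : proofSize lines′ ≤ P ^ 11
    lines′-size = begin
      proofSize lines′                          ≤⟨ proofSize≤length* lines′ (All.map proj₂ allowed) ⟩
      length lines′ * M                         ≤⟨ *-monoˡ-≤ M (≤-trans length≤ (≤-reflexive (+-identityʳ _))) ⟩
      length (lines π) * perInference * M       ≤⟨ *-≤P^ {a = 7} {b = 4} (*-≤P^ {a = 1} {b = 6}
                                                      (≤-trans (≤-trans (length≤proofSize (lines π)) π≤s) s≤P^1) ≤-refl) M≤ ⟩
      P ^ 11                                    ∎

LKDT⇒LKHalf : ∀ k F s → LKDTRef k F s → LKHalfRef k F (qpoly 9 s)
LKDT⇒LKHalf k F s (A , π , valid , LK , π≤s) with []∈? F
... | yes []∈F = []∈⇒LKHalfRef k 9 s []∈F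
... | no []∉F = π′ , π′-LKHalf , π′-size
  where open ExpandedRefutation π valid LK π≤s []∉F

lemma8p10 : (k : ℕ) → Σ ℕ λ c →
    ((F : CNF) (s : ℕ) → LKHalfRef k F s → LKDTRef k F (qpoly c s)) ×
    ((F : CNF) (s : ℕ) → LKDTRef k F s → LKHalfRef k F (qpoly c s))
lemma8p10 k = 9 , LKHalf⇒LKDT k , LKDT⇒LKHalf k
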